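{- Let $y_1,\dots,y_m.u_1,\dots,y_1,\dots,y_m.u_k$ and $x_1,\dots,x_n.s_1,\dots,x_1,\dots,x_n.s_m$ be DHP var-arg lists, where each $y_j$ has the type of $s_j$, and let $\mu=\{y_1\mapsto s_1,\dots,y_m\mapsto s_m\}$. Then $\vec x.u_1\mu,\dots,\vec x.u_k\mu$ is a DHP var-arg list.
   Context: Terms are simply-typed $\lambda$-terms in $\beta\eta$-long normal form. Types are sorts $a$ or $(\sigma_1,\dots,\sigma_n)\to a$. There are typed variables, infinitely many of each type, and typed function symbols $\mathcal{F}$. Terms are generated as follows. If a head $h$ has type $(\sigma_1,\dots,\sigma_n)\to a$ and $t_i:\sigma_i$, then $h(t_1,\dots,t_n):a$. If $t:a$ and $x_i:\sigma_i$, then $x_1,\dots,x_n.t:(\sigma_1,\dots,\sigma_n)\to a$. Terms are taken modulo $\alpha$-renaming, and bound variables are distinct and never free. $\mathrm{fv}$ denotes free variables. $x{\downarrow}=y_1,\dots,y_n.x(y_1{\downarrow},\dots,y_n{\downarrow})$ is the $\eta$-expansion of $x:(\sigma_1,\dots,\sigma_n)\to a$. Subterms: $\vec x.h(s_1,\dots,s_m)\trianglerighteq t$ iff the two are equal or $\vec x.s_i\trianglerighteq t$ for some $i$, with binder prefixes concatenated. $\vartriangleright$ is the strict version of $\trianglerighteq$. Substitution application is hereditary and capture-avoiding: - $x(\vec t)\theta=w\{\vec z\mapsto\vec t\theta\}$ if $\theta(x)=\vec z.w$; - $h(\vec t)\theta=h(\vec t\theta)$ if $h\notin\mathrm{dom}(\theta)$;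 - $(\vec x.t)\theta=\vec z.(t\{\vec x\mapsto\vec z\}\theta)$ for fresh $\vec z$. Expanded terms: $\vec x.s$ is expanded if it equals $\vec x,y_1,\dots,y_k.h(s_1,\dots,s_m,y_1{\downarrow},\dots,y_k{\downarrow})$ with $(\bigcup_i\mathrm{fv}(s_i)\cup\{h\})\cap\{\vec y\}=\varnothing$. Expanded subterms: for $\vec x=x_1,\dots,x_n$, a term $\vec x.s$, and an expanded term $\vec x.t=\vec x,y_1,\dots,y_k.h(t_1,\dots,t_m,\vec y{\downarrow})$, we write $\vec x.s\trianglerighteq_E\vec x.t$ iff there are $n'\ge n$ and terms $x_1,\dots,x_{n'}.t_{m+j}$ ($1\le j\le k$) with $\vec x.s\trianglerighteq x_1,\dots,x_{n'}.h(t_1,\dots,t_{m+k})$. DHP var-arg lists: a list $\vec x.t_1,\dots,\vec x.t_m$ is a DHP var-arg list if for all $1\le i\le m$: - (i) $\varnothing\ne\mathrm{fv}(t_i)\subseteq\{\vec x\}$; - (ii) $\vec x.t_i$ is expanded; - (iii) $\vec x.t_i\not\trianglerighteq_E\vec x.t_j$ for all $j\ne i$. A term $s$ is a DHP if for every subterm $\vec x.y(t_1,\dots,t_m)$ of $s$ with $y\notin\{\vec x\}$, the list $\vec x.t_1,\dots,\vec x.t_m$ is a DHP var-arg list. -}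

module Defs where

open import Data.Product using (Σ; Σ-syntax; _×_; _,_)
open import Data.Sum using (_⊎_; inj₁; inj₂)
open import Relation.Binary.PropositionalEquality using (_≡_)
open import Relation.Nullary using (¬_)

-- Simple types over a set S of sorts.
-- The paper's (σ₁,…,σₙ) → a is represented curried as σ₁ ⇒ (… ⇒ (σₙ ⇒ ι a)).
-- Since all terms are η-long, this is a faithful encoding.

data Ty (S : Set) : Set where
  ι   : S → Ty S
  _⇒_ : Ty S → Ty S → Ty S

infixr 7 _⇒_

data Ctx (S : Set) : Set where
  ε   : Ctx S
  _▷_ : Ctx S → Ty S → Ctx S

infixl 5 _▷_

module _ {S : Set} where

  _⧺_ : Ctx S → Ctx S → Ctx S
  Γ ⧺ ε       = Γ
  Γ ⧺ (X ▷ σ) = (Γ ⧺ X) ▷ σ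

  infixl 4 _⧺_

  data Var : Ctx S → Ty S → Set where
    vz : ∀ {Γ σ} → Var (Γ ▷ σ) σ
    vs : ∀ {Γ σ τ} → Var Γ σ → Var (Γ ▷ τ) σ

  _⇒*_ : Ctx S → Ty S → Ty S
  ε ⇒* τ       = τ
  (X ▷ σ) ⇒* τ = X ⇒* (σ ⇒ τ)

  data SameVar {Γ σ} (x : Var Γ σ) : ∀ {τ} → Var Γ τ → Set where
    same : SameVar x x

  inl : ∀ {Γ σ} (X : Ctx S) → Var Γ σ → Var (Γ ⧺ X) σ
  inl ε       v = v
  inl (X ▷ τ) v = vs (inl X v)

  _-_ : ∀ {σ} (Γ : Ctx S) → Var Γ σ → Ctx S
  (Γ ▷ σ) - vz   = Γ
  (Γ ▷ τ) - vs x = (Γ - x) ▷ τ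

  wkv : ∀ {Γ σ τ} (x : Var Γ σ) → Var (Γ - x) τ → Var Γ τ
  wkv vz     y      = vs y
  wkv (vs x) vz     = vz
  wkv (vs x) (vs y) = vs (wkv x y)

  data EqV {Γ σ} : Var Γ σ → ∀ {τ} → Var Γ τ → Set where
    same : ∀ {x} → EqV x x
    diff : ∀ {τ} (x : Var Γ σ) (y : Var (Γ - x) τ) → EqV x (wkv x y)

  eqv : ∀ {Γ σ τ} (x : Var Γ σ) (y : Var Γ τ) → EqV x y
  eqv vz     vz     = same
  eqv vz     (vs y) = diff vz y
  eqv (vs x) vz     = diff (vs x) vz
  eqv (vs x) (vs y) with eqv x y
  ... | same      = same
  ... | diff .x z = diff (vs x) (vs z)

  Ren : Ctx S → Ctx S → Set
  Ren Γ Δ = ∀ {σ} → Var Γ σ → Var Δ σ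

  liftR : ∀ {Γ Δ τ} → Ren Γ Δ → Ren (Γ ▷ τ) (Δ ▷ τ)
  liftR ρ vz     = vz
  liftR ρ (vs x) = vs (ρ x)

record Signature : Set₁ where
  field
    Sort : Set
    Sym  : Ty Sort → Set

module _ (𝔖 : Signature) where
  open Signature 𝔖

  TY  = Ty Sort
  CTX = Ctx Sort

  data Head (Γ : CTX) (σ : TY) : Set where
    var : Var Γ σ → Head Γ σ
    fun : Sym σ → Head Γ σ

  -- Terms in β-normal η-long form.
  --   lam t      : binder,  x.t
  --   ne h ts    : h(t₁,…,tₙ) of sort a (h fully applied)
  data Nf (Γ : CTX) : TY → Set
  data Sp (Γ : CTX) : TY → Sort → Set

  data Nf Γ where
    lam : ∀ {σ τ} → Nf (Γ ▷ σ) τ → Nf Γ (σ ⇒ τ)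
    ne  : ∀ {σ a} → Head Γ σ → Sp Γ σ a → Nf Γ (ι a)

  data Sp Γ where
    []  : ∀ {a} → Sp Γ (ι a) a
    _∷_ : ∀ {σ τ a} → Nf Γ σ → Sp Γ τ a → Sp Γ (σ ⇒ τ) a

  infixr 5 _∷_

  data PSp (Γ : CTX) (ρ : TY) : TY → Set where
    []  : PSp Γ ρ ρ
    _∷ʳ_ : ∀ {σ τ} → PSp Γ ρ (σ ⇒ τ) → Nf Γ σ → PSp Γ ρ τ

  _++ˢ_ : ∀ {Γ ρ τ a} → PSp Γ ρ τ → Sp Γ τ a → Sp Γ ρ a
  []        ++ˢ rest = rest
  (ps ∷ʳ t) ++ˢ rest = ps ++ˢ (t ∷ rest)

  renH : ∀ {Γ Δ σ} → Ren Γ Δ → Head Γ σ → Head Δ σ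
  renH ρ (var x) = var (ρ x)
  renH ρ (fun f) = fun f

  ren   : ∀ {Γ Δ σ} → Ren Γ Δ → Nf Γ σ → Nf Δ σ
  renSp : ∀ {Γ Δ σ a} → Ren Γ Δ → Sp Γ σ a → Sp Δ σ a
  ren ρ (lam t)   = lam (ren (liftR ρ) t)
  ren ρ (ne h ts) = ne (renH ρ h) (renSp ρ ts)
  renSp ρ []       = []
  renSp ρ (t ∷ ts) = ren ρ t ∷ renSp ρ ts

  renPS : ∀ {Γ Δ ρ τ} → Ren Γ Δ → PSp Γ ρ τ → PSp Δ ρ τ
  renPS ρ []        = []
  renPS ρ (ps ∷ʳ t) = renPS ρ ps ∷ʳ ren ρ t

  -- expand h ps  =  y₁,…,y_k. h(ps, y₁↓, …, y_k↓)   (y's fresh, not free in h, ps)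
  expand : ∀ {Γ ρ} (τ : TY) → Head Γ ρ → PSp Γ ρ τ → Nf Γ τ
  expand (ι a)   h ps = ne h (ps ++ˢ [])
  expand (σ ⇒ τ) h ps =
    lam (expand τ (renH vs h) (renPS vs ps ∷ʳ expand σ (var vz) []))

  _↓ : ∀ {Γ σ} → Var Γ σ → Nf Γ σ
  _↓ {σ = σ} x = expand σ (var x) []

  lams : ∀ {Γ τ} (X : CTX) → Nf (Γ ⧺ X) τ → Nf Γ (X ⇒* τ)
  lams ε       t = t
  lams (X ▷ σ) t = lams X (lam t)

  _[_:=_]  : ∀ {Γ σ τ} → Nf Γ τ → (x : Var Γ σ) → Nf (Γ - x) σ → Nf (Γ - x) τ
  _⟨_:=_⟩  : ∀ {Γ σ τ a} → Sp Γ τ a → (x : Var Γ σ) → Nf (Γ - x) σ → Sp (Γ - x) τ a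
  appSp    : ∀ {Γ} (σ : TY) {a} → Nf Γ σ → Sp Γ σ a → Nf Γ (ι a)
  napp     : ∀ {Γ} (σ τ : TY) → Nf Γ (σ ⇒ τ) → Nf Γ σ → Nf Γ τ
  substHd  : ∀ {Γ σ τ a} → (x : Var Γ σ) → Nf (Γ - x) σ → (y : Var Γ τ) →
             EqV x y → Sp (Γ - x) τ a → Nf (Γ - x) (ι a)

  lam t [ x := u ]         = lam (t [ vs x := ren vs u ])
  ne (var y) ts [ x := u ] = substHd x u y (eqv x y) (ts ⟨ x := u ⟩)
  ne (fun f) ts [ x := u ] = ne (fun f) (ts ⟨ x := u ⟩)

  substHd {σ = σ} x u .x same ts' = appSp σ u ts'
  substHd x u .(wkv x y) (diff .x y) ts' = ne (var y) ts'

  [] ⟨ x := u ⟩       = []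
  (t ∷ ts) ⟨ x := u ⟩ = (t [ x := u ]) ∷ (ts ⟨ x := u ⟩)

  appSp (ι a)   t []       = t
  appSp (σ ⇒ τ) t (u ∷ us) = appSp τ (napp σ τ t u) us

  napp σ τ (lam t) u = t [ vz := u ]

  -- (partial) substitutions: each variable is either mapped to a variable
  -- (not in the domain; renaming needed for capture avoidance) or to a term
  PSub : CTX → CTX → Set
  PSub Γ Δ = ∀ {σ} → Var Γ σ → Var Δ σ ⊎ Nf Δ σ

  liftS : ∀ {Γ Δ τ} → PSub Γ Δ → PSub (Γ ▷ τ) (Δ ▷ τ)
  liftS θ vz = inj₁ vz
  liftS θ (vs x) with θ x
  ... | inj₁ y = inj₁ (vs y)
  ... | inj₂ w = inj₂ (ren vs w)

  sub   : ∀ {Γ Δ σ} → Nf Γ σ → PSub Γ Δ → Nf Δ σ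
  subSp : ∀ {Γ Δ σ a} → Sp Γ σ a → PSub Γ Δ → Sp Δ σ a
  subVar : ∀ {Δ σ a} → Var Δ σ ⊎ Nf Δ σ → Sp Δ σ a → Nf Δ (ι a)

  sub (lam t) θ         = lam (sub t (liftS θ))
  sub (ne (var x) ts) θ = subVar (θ x) (subSp ts θ)
  sub (ne (fun f) ts) θ = ne (fun f) (subSp ts θ)

  subVar (inj₁ y) ts' = ne (var y) ts'
  subVar {σ = σ} (inj₂ w) ts' = appSp σ w ts'

  subSp [] θ       = []
  subSp (t ∷ ts) θ = sub t θ ∷ subSp ts θ

  -- Lists of terms x⃗.t₁,…,x⃗.t_m : indexed by positions in a context T
  -- (T lists the types of the tᵢ); all share the binder prefix x⃗.

  Tms : CTX → CTX → Set
  Tms Δ T = ∀ {σ} → Var T σ → Nf Δ σ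

  μ : ∀ {Γ} (X Y : CTX) → Tms (Γ ⧺ X) Y → PSub (Γ ⧺ Y) (Γ ⧺ X)
  μ X ε       ss v      = inj₁ (inl X v)
  μ X (Y ▷ τ) ss vz     = inj₂ (ss vz)
  μ X (Y ▷ τ) ss (vs v) = μ X Y (λ y → ss (vs y)) v

  data _∈Sp_ {Γ σ} (s : Nf Γ σ) : ∀ {τ a} → Sp Γ τ a → Set where
    here  : ∀ {τ a} {ts : Sp Γ τ a} → s ∈Sp (s ∷ ts)
    there : ∀ {σ' τ a} {t : Nf Γ σ'} {ts : Sp Γ τ a} → s ∈Sp ts → s ∈Sp (t ∷ ts)

  data _∈fv_ {Γ σ} (x : Var Γ σ) : ∀ {τ} → Nf Γ τ → Set where
    lam  : ∀ {σ' τ} {t : Nf (Γ ▷ σ') τ} → vs x ∈fv t → x ∈fv lam t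
    head : ∀ {a} {ts : Sp Γ σ a} → x ∈fv ne (var x) ts
    arg  : ∀ {ρ a σ'} {h : Head Γ ρ} {ts : Sp Γ ρ a} {s : Nf Γ σ'} →
           s ∈Sp ts → x ∈fv s → x ∈fv ne h ts

  -- SubC X s u  :  (x⃗.s) ⊵ u   where X are the types of x⃗
  data SubC {Γ} : ∀ {τ τ'} (X : CTX) → Nf (Γ ⧺ X) τ → Nf Γ τ' → Set where
    here : ∀ {τ X} {s : Nf (Γ ⧺ X) τ} → SubC X s (lams X s)
    lam  : ∀ {σ τ τ' X} {t : Nf (Γ ⧺ X ▷ σ) τ} {u : Nf Γ τ'} →
           SubC (X ▷ σ) t u → SubC X (lam t) u
    arg  : ∀ {ρ a σ τ' X} {h : Head (Γ ⧺ X) ρ} {ts : Sp (Γ ⧺ X) ρ a}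
             {s : Nf (Γ ⧺ X) σ} {u : Nf Γ τ'} →
           s ∈Sp ts → SubC X s u → SubC X (ne h ts) u

  _⊵_ : ∀ {Γ τ τ'} → Nf Γ τ → Nf Γ τ' → Set
  t ⊵ u = SubC ε t u

  -- x⃗.s is expanded:  s = y⃗.h(s₁,…,s_m, y⃗↓) with h, sᵢ not mentioning y⃗
  Expanded : ∀ {Δ τ} → Nf Δ τ → Set
  Expanded {Δ} {τ} s = Σ[ ρ ∈ TY ] Σ[ h ∈ Head Δ ρ ] Σ[ ps ∈ PSp Δ ρ τ ] s ≡ expand τ h ps

  wk : ∀ {Δ} (X' : CTX) → Ren Δ (Δ ⧺ X')
  wk X' = inl X'

  -- x⃗.s ⊵_E x⃗.t  (X = types of x⃗), for t = y⃗.h(t₁,…,t_m, y⃗↓) expanded: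
  -- there are extra binders X' (n' ≥ n) and terms t_{m+1},…,t_{m+k} over x⃗,X'
  -- with x⃗.s ⊵ x₁…x_{n'}.h(t₁,…,t_{m+k})
  SubE : ∀ {Γ τ τ'} (X : CTX) → Nf (Γ ⧺ X) τ → Nf (Γ ⧺ X) τ' → Set
  SubE {Γ} {τ} {τ'} X s t =
    Σ[ ρ ∈ TY ] Σ[ h ∈ Head (Γ ⧺ X) ρ ] Σ[ ps ∈ PSp (Γ ⧺ X) ρ τ' ]
      (t ≡ expand τ' h ps) ×
      (Σ[ X' ∈ CTX ] Σ[ a ∈ Sort ] Σ[ rest ∈ Sp (Γ ⧺ X ⧺ X') τ' a ]
        (lams X s ⊵ lams X (lams X' (ne (renH (wk X') h) (renPS (wk X') ps ++ˢ rest)))))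

  -- DHP var-arg list  x⃗.t₁,…,x⃗.t_m   (Γ: ambient free variables, X: types of x⃗)
  DHPVarArgList : ∀ {T} (Γ X : CTX) → Tms (Γ ⧺ X) T → Set
  DHPVarArgList {T} Γ X ts =
    ∀ {σ} (i : Var T σ) →
      -- (i) ∅ ≠ fv(tᵢ) ⊆ {x⃗}
      (Σ[ σ' ∈ TY ] Σ[ v ∈ Var (Γ ⧺ X) σ' ] v ∈fv ts i) ×
      (∀ {σ'} (v : Var Γ σ') → ¬ (inl X v ∈fv ts i)) ×
      Expanded (ts i) ×
      (∀ {τ} (j : Var T τ) → ¬ SameVar i j → ¬ SubE X (ts i) (ts j))

{-# OPTIONS --safe #-}
module Submission where

-- Write θ for μ = {y⃗ ↦ s⃗}. Since θ commutes with η-expansion, uᵢθ is expanded: a head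
-- y_m(…) of uᵢ becomes g(b, …) when s_m = z⃗.g(b, z⃗↓). Every free variable of uᵢθ comes
-- from a Γ-variable of uᵢ (there is none) or from some s_m, so fv(uᵢθ) ⊆ x⃗; and uᵢ
-- mentions some y_m, whose image contributes a variable of s_m, so fv(uᵢθ) ≠ ∅.
--
-- Condition (iii) rests on two consequences of the DHP conditions on s⃗. First, no image
-- of an s_m can occur inside an argument b of an s_j: for m = j this contradicts the size
-- of s_j, and for m ≠ j the occurrence would show s_j ⊵_E s_m. Second, θ (lifted under any
-- binders) is injective on terms: if a kept head (a function symbol, a Γ- or a bound
-- variable) met the head g of some s_m, then g would be a function symbol and every
-- argument of s_m would be closed, contradicting fv(s_m) ≠ ∅; if the heads of s_m and
-- s_m' met, the argument list of one would be a prefix of the other's, so s_m ⊵_E s_m' or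
-- s_m' ⊵_E s_m. Now an occurrence in uᵢθ that witnesses uᵢθ ⊵_E u_kθ contains an image
-- of some s_l, because u_k mentions some y_l. So it cannot lie inside an argument of an
-- inserted s_j, hence it is the image of an occurrence in uᵢ, and injectivity pulls it
-- back to a witness of uᵢ ⊵_E u_k.

open import Defs
open import Relation.Binary.PropositionalEquality
open import Data.Sum using (_⊎_; inj₁; inj₂)
open import Data.Product using (Σ; _×_; _,_; proj₁; proj₂)
open import Data.Empty using (⊥; ⊥-elim)
open import Data.Nat using (ℕ; zero; suc; _+_; _≤_; s≤s)
open import Data.Nat.Properties
  using (≤-refl; ≤-trans; <-irrefl; m≤m+n; m≤n+m; n≤1+n; module ≤-Reasoning)
open import Relation.Nullary using (¬_)

module Renaming (𝔖 : Signature) where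
  open Signature 𝔖

  infixr 5 _++_

  _++_ : ∀ {Γ ρ τ a} → PSp 𝔖 Γ ρ τ → Sp 𝔖 Γ τ a → Sp 𝔖 Γ ρ a
  _++_ = _++ˢ_ 𝔖

  mutual
    ren-∘ : ∀ {Γ Δ Θ σ} {ρ : Ren Δ Θ} {ρ' : Ren Γ Δ} {ρ'' : Ren Γ Θ} →
            (∀ {τ} (x : Var Γ τ) → ρ (ρ' x) ≡ ρ'' x) → (t : Nf 𝔖 Γ σ) →
            ren 𝔖 ρ (ren 𝔖 ρ' t) ≡ ren 𝔖 ρ'' t
    ren-∘ e (lam t) = cong lam (ren-∘ (λ { vz → refl ; (vs x) → cong vs (e x) }) t)
    ren-∘ e (ne h ts) = cong₂ ne (renH-∘ e h) (renSp-∘ e ts)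

    renH-∘ : ∀ {Γ Δ Θ σ} {ρ : Ren Δ Θ} {ρ' : Ren Γ Δ} {ρ'' : Ren Γ Θ} →
             (∀ {τ} (x : Var Γ τ) → ρ (ρ' x) ≡ ρ'' x) → (h : Head 𝔖 Γ σ) →
             renH 𝔖 ρ (renH 𝔖 ρ' h) ≡ renH 𝔖 ρ'' h
    renH-∘ e (var x) = cong var (e x)
    renH-∘ e (fun f) = refl

    renSp-∘ : ∀ {Γ Δ Θ σ a} {ρ : Ren Δ Θ} {ρ' : Ren Γ Δ} {ρ'' : Ren Γ Θ} →
              (∀ {τ} (x : Var Γ τ) → ρ (ρ' x) ≡ ρ'' x) → (ts : Sp 𝔖 Γ σ a) →
              renSp 𝔖 ρ (renSp 𝔖 ρ' ts) ≡ renSp 𝔖 ρ'' ts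
    renSp-∘ e [] = refl
    renSp-∘ e (t ∷ ts) = cong₂ _∷_ (ren-∘ e t) (renSp-∘ e ts)

  renPS-∘ : ∀ {Γ Δ Θ σ τ} {ρ : Ren Δ Θ} {ρ' : Ren Γ Δ} {ρ'' : Ren Γ Θ} →
            (∀ {τ} (x : Var Γ τ) → ρ (ρ' x) ≡ ρ'' x) → (ps : PSp 𝔖 Γ σ τ) →
            renPS 𝔖 ρ (renPS 𝔖 ρ' ps) ≡ renPS 𝔖 ρ'' ps
  renPS-∘ e [] = refl
  renPS-∘ e (ps ∷ʳ t) = cong₂ _∷ʳ_ (renPS-∘ e ps) (ren-∘ e t)

  mutual
    ren-id : ∀ {Γ σ} {ρ : Ren Γ Γ} → (∀ {τ} (x : Var Γ τ) → ρ x ≡ x) → (t : Nf 𝔖 Γ σ) →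
             ren 𝔖 ρ t ≡ t
    ren-id e (lam t) = cong lam (ren-id (λ { vz → refl ; (vs x) → cong vs (e x) }) t)
    ren-id e (ne h ts) = cong₂ ne (renH-id e h) (renSp-id e ts)

    renH-id : ∀ {Γ σ} {ρ : Ren Γ Γ} → (∀ {τ} (x : Var Γ τ) → ρ x ≡ x) → (h : Head 𝔖 Γ σ) →
              renH 𝔖 ρ h ≡ h
    renH-id e (var x) = cong var (e x)
    renH-id e (fun f) = refl

    renSp-id : ∀ {Γ σ a} {ρ : Ren Γ Γ} → (∀ {τ} (x : Var Γ τ) → ρ x ≡ x) → (ts : Sp 𝔖 Γ σ a) →
               renSp 𝔖 ρ ts ≡ ts
    renSp-id e [] = refl
    renSp-id e (t ∷ ts) = cong₂ _∷_ (ren-id e t) (renSp-id e ts)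

  renPS-id : ∀ {Γ σ τ} {ρ : Ren Γ Γ} → (∀ {τ} (x : Var Γ τ) → ρ x ≡ x) → (ps : PSp 𝔖 Γ σ τ) →
             renPS 𝔖 ρ ps ≡ ps
  renPS-id e [] = refl
  renPS-id e (ps ∷ʳ t) = cong₂ _∷ʳ_ (renPS-id e ps) (ren-id e t)

  ren-cong : ∀ {Γ Δ σ} {ρ ρ' : Ren Γ Δ} → (∀ {τ} (x : Var Γ τ) → ρ x ≡ ρ' x) → (t : Nf 𝔖 Γ σ) →
             ren 𝔖 ρ t ≡ ren 𝔖 ρ' t
  ren-cong e t = trans (sym (ren-id (λ x → refl) _)) (ren-∘ {ρ = λ x → x} e t)

  ren-square : ∀ {Γ Δ Δ' Θ σ} {ρ1 : Ren Δ Θ} {ρ2 : Ren Γ Δ} {ρ3 : Ren Δ' Θ} {ρ4 : Ren Γ Δ'} →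
               (∀ {τ} (x : Var Γ τ) → ρ1 (ρ2 x) ≡ ρ3 (ρ4 x)) → (t : Nf 𝔖 Γ σ) →
               ren 𝔖 ρ1 (ren 𝔖 ρ2 t) ≡ ren 𝔖 ρ3 (ren 𝔖 ρ4 t)
  ren-square e t = trans (ren-∘ e t) (sym (ren-∘ (λ x → refl) t))

  renH-square : ∀ {Γ Δ Δ' Θ σ} {ρ1 : Ren Δ Θ} {ρ2 : Ren Γ Δ} {ρ3 : Ren Δ' Θ} {ρ4 : Ren Γ Δ'} →
                (∀ {τ} (x : Var Γ τ) → ρ1 (ρ2 x) ≡ ρ3 (ρ4 x)) → (t : Head 𝔖 Γ σ) →
                renH 𝔖 ρ1 (renH 𝔖 ρ2 t) ≡ renH 𝔖 ρ3 (renH 𝔖 ρ4 t)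
  renH-square e t = trans (renH-∘ e t) (sym (renH-∘ (λ x → refl) t))

  renPS-square : ∀ {Γ Δ Δ' Θ σ τ} {ρ1 : Ren Δ Θ} {ρ2 : Ren Γ Δ} {ρ3 : Ren Δ' Θ} {ρ4 : Ren Γ Δ'} →
                 (∀ {τ} (x : Var Γ τ) → ρ1 (ρ2 x) ≡ ρ3 (ρ4 x)) → (t : PSp 𝔖 Γ σ τ) →
                 renPS 𝔖 ρ1 (renPS 𝔖 ρ2 t) ≡ renPS 𝔖 ρ3 (renPS 𝔖 ρ4 t)
  renPS-square e t = trans (renPS-∘ e t) (sym (renPS-∘ (λ x → refl) t))

  renSp-++ : ∀ {Γ Δ ρ' τ a} (ρ : Ren Γ Δ) (ps : PSp 𝔖 Γ ρ' τ) (r : Sp 𝔖 Γ τ a) →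
             renSp 𝔖 ρ (ps ++ r) ≡ renPS 𝔖 ρ ps ++ renSp 𝔖 ρ r
  renSp-++ ρ [] r = refl
  renSp-++ ρ (ps ∷ʳ t) r = renSp-++ ρ ps (t ∷ r)

  ren-expand : ∀ {Γ Δ ρ'} (τ : Ty Sort) (ρ : Ren Γ Δ) (h : Head 𝔖 Γ ρ') (ps : PSp 𝔖 Γ ρ' τ) →
               ren 𝔖 ρ (expand 𝔖 τ h ps) ≡ expand 𝔖 τ (renH 𝔖 ρ h) (renPS 𝔖 ρ ps)
  ren-expand (ι a) ρ h ps = cong (ne (renH 𝔖 ρ h)) (renSp-++ ρ ps [])
  ren-expand (σ ⇒ τ) ρ h ps =
    cong lam (trans (ren-expand τ (liftR ρ) (renH 𝔖 vs h) (renPS 𝔖 vs ps ∷ʳ expand 𝔖 σ (var vz) []))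
      (cong₂ (expand 𝔖 τ) (renH-square (λ x → refl) h)
        (cong₂ _∷ʳ_ (renPS-square (λ x → refl) ps) (ren-expand σ (liftR ρ) (var vz) []))))

module HereditarySubstitution (𝔖 : Signature) where
  open Signature 𝔖
  open Renaming 𝔖 public

  eqv-refl : ∀ {Γ : Ctx Sort} {σ} (x : Var Γ σ) → eqv x x ≡ same
  eqv-refl vz = refl
  eqv-refl (vs x) rewrite eqv-refl x = refl

  eqv-wkv : ∀ {Γ : Ctx Sort} {σ τ} (x : Var Γ σ) (y : Var (Γ - x) τ) → eqv x (wkv x y) ≡ diff x y
  eqv-wkv vz y = refl
  eqv-wkv (vs x) vz = refl
  eqv-wkv (vs x) (vs y) rewrite eqv-wkv x y = refl

  substHd-wkv : ∀ {Γ σ τ a} (x : Var Γ σ) (u : Nf 𝔖 (Γ - x) σ) (y : Var (Γ - x) τ)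
                (sp : Sp 𝔖 (Γ - x) τ a) →
                substHd 𝔖 x u (wkv x y) (eqv x (wkv x y)) sp ≡ ne (var y) sp
  substHd-wkv x u y sp rewrite eqv-wkv x y = refl

  substHd-same : ∀ {Γ σ a} (x : Var Γ σ) (u : Nf 𝔖 (Γ - x) σ) (sp : Sp 𝔖 (Γ - x) σ a) →
                 substHd 𝔖 x u x (eqv x x) sp ≡ appSp 𝔖 σ u sp
  substHd-same x u sp rewrite eqv-refl x = refl

  substPS : ∀ {Γ σ ρ τ} → PSp 𝔖 Γ ρ τ → (x : Var Γ σ) → Nf 𝔖 (Γ - x) σ → PSp 𝔖 (Γ - x) ρ τ
  substPS [] x u = []
  substPS (ps ∷ʳ t) x u = substPS ps x u ∷ʳ _[_:=_] 𝔖 t x u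

  ⟨:=⟩-++ : ∀ {Γ σ ρ τ a} (ps : PSp 𝔖 Γ ρ τ) (r : Sp 𝔖 Γ τ a) (x : Var Γ σ) (u : Nf 𝔖 (Γ - x) σ) →
            _⟨_:=_⟩ 𝔖 (ps ++ r) x u ≡ substPS ps x u ++ _⟨_:=_⟩ 𝔖 r x u
  ⟨:=⟩-++ [] r x u = refl
  ⟨:=⟩-++ (ps ∷ʳ t) r x u = ⟨:=⟩-++ ps (t ∷ r) x u

  mutual
    [:=]-wkv : ∀ {Γ σ τ} (x : Var Γ σ) {ρ : Ren (Γ - x) Γ} →
               (∀ {τ} (y : Var (Γ - x) τ) → ρ y ≡ wkv x y) →
               (t : Nf 𝔖 (Γ - x) τ) (u : Nf 𝔖 (Γ - x) σ) → _[_:=_] 𝔖 (ren 𝔖 ρ t) x u ≡ t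
    [:=]-wkv x e (lam t) u =
      cong lam ([:=]-wkv (vs x) (λ { vz → refl ; (vs y) → cong vs (e y) }) t (ren 𝔖 vs u))
    [:=]-wkv x {ρ} e (ne (var y) ts) u rewrite e y =
      trans (substHd-wkv x u y _) (cong (ne (var y)) (⟨:=⟩-wkv x e ts u))
    [:=]-wkv x e (ne (fun f) ts) u = cong (ne (fun f)) (⟨:=⟩-wkv x e ts u)

    ⟨:=⟩-wkv : ∀ {Γ σ τ a} (x : Var Γ σ) {ρ : Ren (Γ - x) Γ} →
               (∀ {τ} (y : Var (Γ - x) τ) → ρ y ≡ wkv x y) →
               (ts : Sp 𝔖 (Γ - x) τ a) (u : Nf 𝔖 (Γ - x) σ) → _⟨_:=_⟩ 𝔖 (renSp 𝔖 ρ ts) x u ≡ ts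
    ⟨:=⟩-wkv x e [] u = refl
    ⟨:=⟩-wkv x e (t ∷ ts) u = cong₂ _∷_ ([:=]-wkv x e t u) (⟨:=⟩-wkv x e ts u)

  substPS-wkv : ∀ {Γ σ ρ' τ} (x : Var Γ σ) {ρ : Ren (Γ - x) Γ} →
                (∀ {τ} (y : Var (Γ - x) τ) → ρ y ≡ wkv x y) →
                (ps : PSp 𝔖 (Γ - x) ρ' τ) (u : Nf 𝔖 (Γ - x) σ) → substPS (renPS 𝔖 ρ ps) x u ≡ ps
  substPS-wkv x e [] u = refl
  substPS-wkv x e (ps ∷ʳ t) u = cong₂ _∷ʳ_ (substPS-wkv x e ps u) ([:=]-wkv x e t u)

  mutual
    ren-[:=] : ∀ {Γ Δ} (σ : Ty Sort) {τ} (ρ : Ren Γ Δ) (x : Var Γ σ) (ρ' : Ren (Γ - x) (Δ - ρ x)) →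
               (∀ {τ} (y : Var (Γ - x) τ) → ρ (wkv x y) ≡ wkv (ρ x) (ρ' y)) →
               (t : Nf 𝔖 Γ τ) (u : Nf 𝔖 (Γ - x) σ) →
               ren 𝔖 ρ' (_[_:=_] 𝔖 t x u) ≡ _[_:=_] 𝔖 (ren 𝔖 ρ t) (ρ x) (ren 𝔖 ρ' u)
    ren-[:=] σ ρ x ρ' e (lam t) u =
      cong lam (trans (ren-[:=] σ (liftR ρ) (vs x) (liftR ρ')
                        (λ { vz → refl ; (vs y) → cong vs (e y) }) t (ren 𝔖 vs u))
                 (cong (_[_:=_] 𝔖 (ren 𝔖 (liftR ρ) t) (vs (ρ x))) (ren-square (λ y → refl) u)))
    ren-[:=] σ ρ x ρ' e (ne (var y) ts) u with eqv x y
    ... | same = trans (ren-appSp σ ρ' u (_⟨_:=_⟩ 𝔖 ts x u))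
                   (trans (cong (appSp 𝔖 σ (ren 𝔖 ρ' u)) (renSp-⟨:=⟩ σ ρ x ρ' e ts u))
                      (sym (substHd-same (ρ x) (ren 𝔖 ρ' u) _)))
    ... | diff .x y' rewrite e y' =
          trans (cong (ne (var (ρ' y'))) (renSp-⟨:=⟩ σ ρ x ρ' e ts u))
                (sym (substHd-wkv (ρ x) (ren 𝔖 ρ' u) (ρ' y') _))
    ren-[:=] σ ρ x ρ' e (ne (fun f) ts) u = cong (ne (fun f)) (renSp-⟨:=⟩ σ ρ x ρ' e ts u)

    renSp-⟨:=⟩ : ∀ {Γ Δ} (σ : Ty Sort) {τ a} (ρ : Ren Γ Δ) (x : Var Γ σ)
                 (ρ' : Ren (Γ - x) (Δ - ρ x)) →
                 (∀ {τ} (y : Var (Γ - x) τ) → ρ (wkv x y) ≡ wkv (ρ x) (ρ' y)) →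
                 (ts : Sp 𝔖 Γ τ a) (u : Nf 𝔖 (Γ - x) σ) →
                 renSp 𝔖 ρ' (_⟨_:=_⟩ 𝔖 ts x u) ≡ _⟨_:=_⟩ 𝔖 (renSp 𝔖 ρ ts) (ρ x) (ren 𝔖 ρ' u)
    renSp-⟨:=⟩ σ ρ x ρ' e [] u = refl
    renSp-⟨:=⟩ σ ρ x ρ' e (t ∷ ts) u = cong₂ _∷_ (ren-[:=] σ ρ x ρ' e t u)
        (renSp-⟨:=⟩ σ ρ x ρ' e ts u)

    ren-appSp : ∀ {Γ Δ a} (σ : Ty Sort) (ρ : Ren Γ Δ) (u : Nf 𝔖 Γ σ) (sp : Sp 𝔖 Γ σ a) →
                ren 𝔖 ρ (appSp 𝔖 σ u sp) ≡ appSp 𝔖 σ (ren 𝔖 ρ u) (renSp 𝔖 ρ sp)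
    ren-appSp (ι a) ρ u [] = refl
    ren-appSp (σ ⇒ τ) ρ u (t ∷ sp) =
      trans (ren-appSp τ ρ (napp 𝔖 σ τ u t) sp)
            (cong (λ w → appSp 𝔖 τ w (renSp 𝔖 ρ sp)) (ren-napp σ τ ρ u t))

    ren-napp : ∀ {Γ Δ} (σ τ : Ty Sort) (ρ : Ren Γ Δ) (u : Nf 𝔖 Γ (σ ⇒ τ)) (t : Nf 𝔖 Γ σ) →
               ren 𝔖 ρ (napp 𝔖 σ τ u t) ≡ napp 𝔖 σ τ (ren 𝔖 ρ u) (ren 𝔖 ρ t)
    ren-napp σ τ ρ (lam b) t = ren-[:=] σ (liftR ρ) vz ρ (λ y → refl) b t

  renPS-substPS : ∀ {Γ Δ} (σ : Ty Sort) {ρ0 τ} (ρ : Ren Γ Δ) (x : Var Γ σ)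
                  (ρ' : Ren (Γ - x) (Δ - ρ x)) →
                  (∀ {τ} (y : Var (Γ - x) τ) → ρ (wkv x y) ≡ wkv (ρ x) (ρ' y)) →
                  (ps : PSp 𝔖 Γ ρ0 τ) (u : Nf 𝔖 (Γ - x) σ) →
                  renPS 𝔖 ρ' (substPS ps x u) ≡ substPS (renPS 𝔖 ρ ps) (ρ x) (ren 𝔖 ρ' u)
  renPS-substPS σ ρ x ρ' e [] u = refl
  renPS-substPS σ ρ x ρ' e (ps ∷ʳ t) u = cong₂ _∷ʳ_ (renPS-substPS σ ρ x ρ' e ps u)
      (ren-[:=] σ ρ x ρ' e t u)

  [:=]-expand : ∀ {Γ σ ρ'} (τ : Ty Sort) (x : Var Γ σ) (u : Nf 𝔖 (Γ - x) σ) (h : Head 𝔖 (Γ - x) ρ')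
                (ps : PSp 𝔖 Γ ρ' τ) →
                _[_:=_] 𝔖 (expand 𝔖 τ (renH 𝔖 (wkv x) h) ps) x u ≡ expand 𝔖 τ h (substPS ps x u)
  [:=]-expand (ι a) x u (var y) ps =
    trans (substHd-wkv x u y _) (cong (ne (var y)) (⟨:=⟩-++ ps [] x u))
  [:=]-expand (ι a) x u (fun f) ps = cong (ne (fun f)) (⟨:=⟩-++ ps [] x u)
  [:=]-expand {σ = σ} (σ' ⇒ τ) x u (var y) ps =
    cong lam (trans
        ([:=]-expand τ (vs x) (ren 𝔖 vs u) (var (vs y)) (renPS 𝔖 vs ps ∷ʳ expand 𝔖 σ' (var vz) []))
      (cong (expand 𝔖 τ (var (vs y)))
        (cong₂ _∷ʳ_ (sym (renPS-substPS σ vs x vs (λ y → refl) ps u))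
                    ([:=]-expand σ' (vs x) (ren 𝔖 vs u) (var vz) []))))
  [:=]-expand {σ = σ} (σ' ⇒ τ) x u (fun f) ps =
    cong lam (trans
        ([:=]-expand τ (vs x) (ren 𝔖 vs u) (fun f) (renPS 𝔖 vs ps ∷ʳ expand 𝔖 σ' (var vz) []))
      (cong (expand 𝔖 τ (fun f))
        (cong₂ _∷ʳ_ (sym (renPS-substPS σ vs x vs (λ y → refl) ps u))
                    ([:=]-expand σ' (vs x) (ren 𝔖 vs u) (var vz) []))))

  appPS : ∀ {Γ ρ τ} → Nf 𝔖 Γ ρ → PSp 𝔖 Γ ρ τ → Nf 𝔖 Γ τ
  appPS u [] = u
  appPS u (_∷ʳ_ {σ} {τ} ps t) = napp 𝔖 σ τ (appPS u ps) t

  appSp-++ : ∀ {Γ τ a} (ρ : Ty Sort) (u : Nf 𝔖 Γ ρ) (ps : PSp 𝔖 Γ ρ τ) (r : Sp 𝔖 Γ τ a) →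
             appSp 𝔖 ρ u (ps ++ r) ≡ appSp 𝔖 τ (appPS u ps) r
  appSp-++ ρ u [] r = refl
  appSp-++ ρ u (ps ∷ʳ t) r = appSp-++ ρ u ps (t ∷ r)

  ren-appPS : ∀ {Γ Δ ρ' τ} (ρ : Ren Γ Δ) (u : Nf 𝔖 Γ ρ') (ps : PSp 𝔖 Γ ρ' τ) →
              ren 𝔖 ρ (appPS u ps) ≡ appPS (ren 𝔖 ρ u) (renPS 𝔖 ρ ps)
  ren-appPS ρ u [] = refl
  ren-appPS ρ u (_∷ʳ_ {σ} {τ} ps t) =
    trans (ren-napp σ τ ρ (appPS u ps) t) (cong (λ w → napp 𝔖 σ τ w (ren 𝔖 ρ t)) (ren-appPS ρ u ps))

  collapseEqV : ∀ {Γ : Ctx Sort} {σ τ} {x : Var Γ σ} (y : Var (Γ - x) σ) {v : Var Γ τ} → EqV x v →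
                Var (Γ - x) τ
  collapseEqV y same = y
  collapseEqV y (diff x v') = v'

  collapse : ∀ {Γ : Ctx Sort} {σ} (x : Var Γ σ) (y : Var (Γ - x) σ) → Ren Γ (Γ - x)
  collapse x y v = collapseEqV y (eqv x v)

  collapse-lift : ∀ {Γ : Ctx Sort} {σ ρ τ} (x : Var Γ σ) (y : Var (Γ - x) σ) (v : Var (Γ ▷ ρ) τ) →
                  collapse (vs x) (vs y) v ≡ liftR (collapse x y) v
  collapse-lift x y vz = refl
  collapse-lift x y (vs v) with eqv x v
  ... | same = refl
  ... | diff .x v' = refl

  -- Applying an η-expansion means substituting η-expanded variables, which in turn means
  -- applying η-expansions at smaller types.
  mutual
    appSp-expand : ∀ {Δ ρ a} (σ : Ty Sort) (h : Head 𝔖 Δ ρ) (ps : PSp 𝔖 Δ ρ σ) (sp : Sp 𝔖 Δ σ a) →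
                   appSp 𝔖 σ (expand 𝔖 σ h ps) sp ≡ ne h (ps ++ sp)
    appSp-expand (ι a) h ps [] = refl
    appSp-expand (σ ⇒ τ) h ps (t ∷ sp) =
      trans (cong (λ w → appSp 𝔖 τ w sp)
               (trans ([:=]-expand τ vz t h (renPS 𝔖 vs ps ∷ʳ expand 𝔖 σ (var vz) []))
                      (cong (expand 𝔖 τ h) (cong₂ _∷ʳ_ (substPS-wkv vz (λ y → refl) ps t)
                                                        ([:=]-expand-var σ σ vz t [])))))
            (appSp-expand τ h (ps ∷ʳ t) sp)

    [:=]-expand-var : ∀ {Γ} (ρ τ : Ty Sort) (x : Var Γ ρ) (u : Nf 𝔖 (Γ - x) ρ)
                      (ps0 : PSp 𝔖 (Γ - x) ρ τ) →
                      _[_:=_] 𝔖 (expand 𝔖 τ (var x) (renPS 𝔖 (wkv x) ps0)) x u ≡ appPS u ps0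
    [:=]-expand-var ρ (ι a) x u ps0 =
      trans (substHd-same x u _)
        (trans (cong (appSp 𝔖 ρ u) (trans (⟨:=⟩-++ (renPS 𝔖 (wkv x) ps0) [] x u)
                                          (cong (λ q → q ++ [])
                                              (substPS-wkv x (λ y → refl) ps0 u))))
               (appSp-++ ρ u ps0 []))
    [:=]-expand-var ρ (σ ⇒ τ) x u ps0 =
      trans (cong lam
        (trans (cong (λ q → _[_:=_] 𝔖 (expand 𝔖 τ (var (vs x)) q) (vs x) (ren 𝔖 vs u))
                 (cong₂ _∷ʳ_ (renPS-square (λ y → refl) ps0)
                     (sym (ren-expand σ (wkv (vs x)) (var vz) []))))
         (trans ([:=]-expand-var ρ τ (vs x) (ren 𝔖 vs u) (renPS 𝔖 vs ps0 ∷ʳ expand 𝔖 σ (var vz) []))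
                (cong (λ w → napp 𝔖 σ τ w (expand 𝔖 σ (var vz) [])) (sym (ren-appPS vs u ps0))))))
        (lam-napp-η σ τ (appPS u ps0))

    lam-napp-η : ∀ {Δ} (σ τ : Ty Sort) (w : Nf 𝔖 Δ (σ ⇒ τ)) →
                 lam (napp 𝔖 σ τ (ren 𝔖 vs w) (expand 𝔖 σ (var vz) [])) ≡ w
    lam-napp-η σ τ (lam t) =
      cong lam (trans ([:=]-var↓ σ vz vz (ren 𝔖 (liftR vs) t))
                 (trans (ren-∘ (λ { vz → refl ; (vs v) → refl }) t) (ren-id (λ v → refl) t)))

    [:=]-var↓ : ∀ {Γ τ} (σ : Ty Sort) (x : Var Γ σ) (y : Var (Γ - x) σ) (t : Nf 𝔖 Γ τ) →
                _[_:=_] 𝔖 t x (expand 𝔖 σ (var y) []) ≡ ren 𝔖 (collapse x y) t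
    [:=]-var↓ σ x y (lam t) =
      cong lam (trans (cong (_[_:=_] 𝔖 t (vs x)) (ren-expand σ vs (var y) []))
                 (trans ([:=]-var↓ σ (vs x) (vs y) t) (ren-cong (collapse-lift x y) t)))
    [:=]-var↓ σ x y (ne (var v) ts) with eqv x v
    ... | same = trans (appSp-expand σ (var y) [] (_⟨_:=_⟩ 𝔖 ts x (expand 𝔖 σ (var y) [])))
                   (cong (ne (var y)) (⟨:=⟩-var↓ σ x y ts))
    ... | diff .x v' = cong (ne (var v')) (⟨:=⟩-var↓ σ x y ts)
    [:=]-var↓ σ x y (ne (fun f) ts) = cong (ne (fun f)) (⟨:=⟩-var↓ σ x y ts)

    ⟨:=⟩-var↓ : ∀ {Γ τ a} (σ : Ty Sort) (x : Var Γ σ) (y : Var (Γ - x) σ) (ts : Sp 𝔖 Γ τ a) →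
                _⟨_:=_⟩ 𝔖 ts x (expand 𝔖 σ (var y) []) ≡ renSp 𝔖 (collapse x y) ts
    ⟨:=⟩-var↓ σ x y [] = refl
    ⟨:=⟩-var↓ σ x y (t ∷ ts) = cong₂ _∷_ ([:=]-var↓ σ x y t) (⟨:=⟩-var↓ σ x y ts)

module ParallelSubstitution (𝔖 : Signature) where
  open Signature 𝔖
  open HereditarySubstitution 𝔖 public

  ren⊎ : ∀ {Δ Δ' : Ctx Sort} {σ} → Ren Δ Δ' → Var Δ σ ⊎ Nf 𝔖 Δ σ → Var Δ' σ ⊎ Nf 𝔖 Δ' σ
  ren⊎ ρ (inj₁ y) = inj₁ (ρ y)
  ren⊎ ρ (inj₂ w) = inj₂ (ren 𝔖 ρ w)

  liftS-vs : ∀ {Γ Δ σ τ} (θ : PSub 𝔖 Γ Δ) (x : Var Γ σ) → liftS 𝔖 {τ = τ} θ (vs x) ≡ ren⊎ vs (θ x)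
  liftS-vs θ x with θ x
  ... | inj₁ y = refl
  ... | inj₂ w = refl

  liftS-cong : ∀ {Γ Δ τ} {θ θ' : PSub 𝔖 Γ Δ} → (∀ {σ} (x : Var Γ σ) → θ x ≡ θ' x) →
               ∀ {σ} (x : Var (Γ ▷ τ) σ) → liftS 𝔖 θ x ≡ liftS 𝔖 θ' x
  liftS-cong e vz = refl
  liftS-cong {θ = θ} {θ'} e (vs x) = trans (liftS-vs θ x)
      (trans (cong (ren⊎ vs) (e x)) (sym (liftS-vs θ' x)))

  mutual
    sub-cong : ∀ {Γ Δ τ} {θ θ' : PSub 𝔖 Γ Δ} → (∀ {σ} (x : Var Γ σ) → θ x ≡ θ' x) → (t : Nf 𝔖 Γ τ) →
               sub 𝔖 t θ ≡ sub 𝔖 t θ'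
    sub-cong e (lam t) = cong lam (sub-cong (liftS-cong e) t)
    sub-cong e (ne (var x) ts) = cong₂ (subVar 𝔖) (e x) (subSp-cong e ts)
    sub-cong e (ne (fun f) ts) = cong (ne (fun f)) (subSp-cong e ts)

    subSp-cong : ∀ {Γ Δ τ a} {θ θ' : PSub 𝔖 Γ Δ} → (∀ {σ} (x : Var Γ σ) → θ x ≡ θ' x) →
                 (ts : Sp 𝔖 Γ τ a) → subSp 𝔖 ts θ ≡ subSp 𝔖 ts θ'
    subSp-cong e [] = refl
    subSp-cong e (t ∷ ts) = cong₂ _∷_ (sub-cong e t) (subSp-cong e ts)

  mutual
    sub-ren : ∀ {Γ Γ' Δ τ} (ρ : Ren Γ Γ') (θ : PSub 𝔖 Γ' Δ) (t : Nf 𝔖 Γ τ) →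
              sub 𝔖 (ren 𝔖 ρ t) θ ≡ sub 𝔖 t (λ x → θ (ρ x))
    sub-ren ρ θ (lam t) =
      cong lam (trans (sub-ren (liftR ρ) (liftS 𝔖 θ) t)
        (sub-cong (λ { vz → refl ; (vs x) →
            trans (liftS-vs θ (ρ x)) (sym (liftS-vs (λ y → θ (ρ y)) x)) }) t))
    sub-ren ρ θ (ne (var x) ts) = cong (subVar 𝔖 (θ (ρ x))) (subSp-ren ρ θ ts)
    sub-ren ρ θ (ne (fun f) ts) = cong (ne (fun f)) (subSp-ren ρ θ ts)

    subSp-ren : ∀ {Γ Γ' Δ τ a} (ρ : Ren Γ Γ') (θ : PSub 𝔖 Γ' Δ) (ts : Sp 𝔖 Γ τ a) →
                subSp 𝔖 (renSp 𝔖 ρ ts) θ ≡ subSp 𝔖 ts (λ x → θ (ρ x))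
    subSp-ren ρ θ [] = refl
    subSp-ren ρ θ (t ∷ ts) = cong₂ _∷_ (sub-ren ρ θ t) (subSp-ren ρ θ ts)

  ren⊎-liftS : ∀ {Γ Δ Δ' τ σ} (ρ : Ren Δ Δ') (θ : PSub 𝔖 Γ Δ) (x : Var (Γ ▷ τ) σ) →
               ren⊎ (liftR ρ) (liftS 𝔖 θ x) ≡ liftS 𝔖 (λ y → ren⊎ ρ (θ y)) x
  ren⊎-liftS ρ θ vz = refl
  ren⊎-liftS ρ θ (vs x) with θ x
  ... | inj₁ y = refl
  ... | inj₂ w = cong inj₂ (ren-square (λ y → refl) w)

  mutual
    ren-sub : ∀ {Γ Δ Δ' τ} (ρ : Ren Δ Δ') (θ : PSub 𝔖 Γ Δ) (t : Nf 𝔖 Γ τ) →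
              ren 𝔖 ρ (sub 𝔖 t θ) ≡ sub 𝔖 t (λ x → ren⊎ ρ (θ x))
    ren-sub ρ θ (lam t) = cong lam
        (trans (ren-sub (liftR ρ) (liftS 𝔖 θ) t) (sub-cong (ren⊎-liftS ρ θ) t))
    ren-sub ρ θ (ne (var x) ts) with θ x
    ... | inj₁ y = cong (ne (var (ρ y))) (renSp-subSp ρ θ ts)
    ... | inj₂ w = trans (ren-appSp _ ρ w (subSp 𝔖 ts θ))
        (cong (appSp 𝔖 _ (ren 𝔖 ρ w)) (renSp-subSp ρ θ ts))
    ren-sub ρ θ (ne (fun f) ts) = cong (ne (fun f)) (renSp-subSp ρ θ ts)

    renSp-subSp : ∀ {Γ Δ Δ' τ a} (ρ : Ren Δ Δ') (θ : PSub 𝔖 Γ Δ) (ts : Sp 𝔖 Γ τ a) →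
                  renSp 𝔖 ρ (subSp 𝔖 ts θ) ≡ subSp 𝔖 ts (λ x → ren⊎ ρ (θ x))
    renSp-subSp ρ θ [] = refl
    renSp-subSp ρ θ (t ∷ ts) = cong₂ _∷_ (ren-sub ρ θ t) (renSp-subSp ρ θ ts)

  sub-wk : ∀ {Γ Δ σ τ} (θ : PSub 𝔖 Γ Δ) (t : Nf 𝔖 Γ τ) →
           sub 𝔖 (ren 𝔖 (vs {τ = σ}) t) (liftS 𝔖 θ) ≡ ren 𝔖 vs (sub 𝔖 t θ)
  sub-wk θ t = trans (sub-ren vs (liftS 𝔖 θ) t)
                 (trans (sub-cong (λ x → liftS-vs θ x) t) (sym (ren-sub vs θ t)))

  subPS : ∀ {Γ Δ ρ τ} → PSp 𝔖 Γ ρ τ → PSub 𝔖 Γ Δ → PSp 𝔖 Δ ρ τ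
  subPS [] θ = []
  subPS (ps ∷ʳ t) θ = subPS ps θ ∷ʳ sub 𝔖 t θ

  subPS-wk : ∀ {Γ Δ σ ρ τ} (θ : PSub 𝔖 Γ Δ) (ps : PSp 𝔖 Γ ρ τ) →
             subPS (renPS 𝔖 (vs {τ = σ}) ps) (liftS 𝔖 θ) ≡ renPS 𝔖 vs (subPS ps θ)
  subPS-wk θ [] = refl
  subPS-wk θ (ps ∷ʳ t) = cong₂ _∷ʳ_ (subPS-wk θ ps) (sub-wk θ t)

  subSp-++ : ∀ {Γ Δ ρ τ a} (ps : PSp 𝔖 Γ ρ τ) (r : Sp 𝔖 Γ τ a) (θ : PSub 𝔖 Γ Δ) →
             subSp 𝔖 (ps ++ r) θ ≡ subPS ps θ ++ subSp 𝔖 r θ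
  subSp-++ [] r θ = refl
  subSp-++ (ps ∷ʳ t) r θ = subSp-++ ps (t ∷ r) θ

  _++ᴾ_ : ∀ {Γ ρ τ τ'} → PSp 𝔖 Γ ρ τ → PSp 𝔖 Γ τ τ' → PSp 𝔖 Γ ρ τ'
  P ++ᴾ [] = P
  P ++ᴾ (Q ∷ʳ t) = (P ++ᴾ Q) ∷ʳ t

  ++ᴾ-++ : ∀ {Γ ρ τ τ' a} (P : PSp 𝔖 Γ ρ τ) (Q : PSp 𝔖 Γ τ τ') (r : Sp 𝔖 Γ τ' a) →
           (P ++ᴾ Q) ++ r ≡ P ++ Q ++ r
  ++ᴾ-++ P [] r = refl
  ++ᴾ-++ P (Q ∷ʳ t) r = ++ᴾ-++ P Q (t ∷ r)

  renPS-++ᴾ : ∀ {Γ Δ ρ τ τ'} (ρ' : Ren Γ Δ) (P : PSp 𝔖 Γ ρ τ) (Q : PSp 𝔖 Γ τ τ') →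
              renPS 𝔖 ρ' (P ++ᴾ Q) ≡ renPS 𝔖 ρ' P ++ᴾ renPS 𝔖 ρ' Q
  renPS-++ᴾ ρ' P [] = refl
  renPS-++ᴾ ρ' P (Q ∷ʳ t) = cong (_∷ʳ ren 𝔖 ρ' t) (renPS-++ᴾ ρ' P Q)

  -- θ sends h(ts) to H(P, ts θ); for a variable x this needs θ x to be the expansion of H(P, …).
  data HeadImage {Γ Δ} (θ : PSub 𝔖 Γ Δ) :
                 ∀ {σ ρ} → Head 𝔖 Γ σ → Head 𝔖 Δ ρ → PSp 𝔖 Δ ρ σ → Set where
    hi-fun : ∀ {σ} {f : Sym σ} → HeadImage θ (fun f) (fun f) []
    hi-var : ∀ {σ} {x : Var Γ σ} {y : Var Δ σ} → θ x ≡ inj₁ y → HeadImage θ (var x) (var y) []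
    hi-sub : ∀ {σ ρ} {x : Var Γ σ} {H : Head 𝔖 Δ ρ} {P : PSp 𝔖 Δ ρ σ} →
             θ x ≡ inj₂ (expand 𝔖 σ H P) → HeadImage θ (var x) H P

  sub-ne : ∀ {Γ Δ σ ρ a} {θ : PSub 𝔖 Γ Δ} {h : Head 𝔖 Γ σ} {H : Head 𝔖 Δ ρ} {P : PSp 𝔖 Δ ρ σ} →
           HeadImage θ h H P → (ts : Sp 𝔖 Γ σ a) → sub 𝔖 (ne h ts) θ ≡ ne H (P ++ subSp 𝔖 ts θ)
  sub-ne hi-fun ts = refl
  sub-ne (hi-var e) ts rewrite e = refl
  sub-ne {σ = σ} {θ = θ} (hi-sub e) ts rewrite e = appSp-expand σ _ _ (subSp 𝔖 ts θ)

  HeadImage-wk : ∀ {Γ Δ σ ρ τ} {θ : PSub 𝔖 Γ Δ} {h : Head 𝔖 Γ σ} {H : Head 𝔖 Δ ρ}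
                 {P : PSp 𝔖 Δ ρ σ} →
                 HeadImage θ h H P →
                 HeadImage (liftS 𝔖 {τ = τ} θ) (renH 𝔖 vs h) (renH 𝔖 vs H) (renPS 𝔖 vs P)
  HeadImage-wk hi-fun = hi-fun
  HeadImage-wk {θ = θ} (hi-var {x = x} e) = hi-var (trans (liftS-vs θ x) (cong (ren⊎ vs) e))
  HeadImage-wk {σ = σ} {θ = θ} (hi-sub {x = x} {H} {P} e) =
    hi-sub (trans (liftS-vs θ x) (trans (cong (ren⊎ vs) e) (cong inj₂ (ren-expand σ vs H P))))

  sub-expand : ∀ {Γ Δ σ ρ} (τ : Ty Sort) {θ : PSub 𝔖 Γ Δ} {h : Head 𝔖 Γ σ} {H : Head 𝔖 Δ ρ}
               {P : PSp 𝔖 Δ ρ σ} →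
               HeadImage θ h H P → (ps : PSp 𝔖 Γ σ τ) →
               sub 𝔖 (expand 𝔖 τ h ps) θ ≡ expand 𝔖 τ H (P ++ᴾ subPS ps θ)
  sub-expand (ι a) {θ} {P = P} hi ps =
    trans (sub-ne hi (ps ++ []))
      (cong (ne _) (trans (cong (P ++_) (subSp-++ ps [] θ)) (sym (++ᴾ-++ P (subPS ps θ) []))))
  sub-expand (σ ⇒ τ) {θ} {H = H} {P} hi ps =
    cong lam (trans (sub-expand τ (HeadImage-wk hi) (renPS 𝔖 vs ps ∷ʳ expand 𝔖 σ (var vz) []))
      (cong (expand 𝔖 τ (renH 𝔖 vs H))
        (trans (cong₂ (λ q w → renPS 𝔖 vs P ++ᴾ (q ∷ʳ w)) (subPS-wk θ ps)
                  (sub-expand σ (hi-var refl) []))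
          (cong (_∷ʳ expand 𝔖 σ (var vz) []) (sym (renPS-++ᴾ vs P (subPS ps θ)))))))

module Injectivity (𝔖 : Signature) where
  open Signature 𝔖
  open ParallelSubstitution 𝔖 public

  SameVar-sym : ∀ {Γ : Ctx Sort} {σ τ} {x : Var Γ σ} {y : Var Γ τ} → SameVar x y → SameVar y x
  SameVar-sym same = same

  SameVar-vs : ∀ {Γ : Ctx Sort} {σ τ ρ} {x : Var Γ σ} {y : Var Γ τ} →
               SameVar (vs {τ = ρ} x) (vs y) → SameVar x y
  SameVar-vs same = same

  ¬SameVar-wkv : ∀ {Γ : Ctx Sort} {σ τ} (x : Var Γ σ) (y : Var (Γ - x) τ) → SameVar x (wkv x y) → ⊥
  ¬SameVar-wkv vz y ()
  ¬SameVar-wkv (vs x) vz ()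
  ¬SameVar-wkv (vs x) (vs y) p = ¬SameVar-wkv x y (SameVar-vs p)

  inr : ∀ {Δ : Ctx Sort} {σ} (Z : Ctx Sort) → Var Z σ → Var (Δ ⧺ Z) σ
  inr (Z ▷ τ) vz = vz
  inr (Z ▷ τ) (vs z) = vs (inr Z z)

  data VarView {Δ : Ctx Sort} {σ} (Z : Ctx Sort) : Var (Δ ⧺ Z) σ → Set where
    left : (w : Var Δ σ) → VarView Z (inl Z w)
    right : (z : Var Z σ) → VarView Z (inr Z z)

  varView : ∀ {Δ : Ctx Sort} {σ} (Z : Ctx Sort) (v : Var (Δ ⧺ Z) σ) → VarView Z v
  varView ε v = left v
  varView (Z ▷ τ) vz = right vz
  varView (Z ▷ τ) (vs v) with varView Z v
  ... | left w = left w
  ... | right z = right (vs z)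

  vs-inj : ∀ {Δ : Ctx Sort} {σ τ} {x y : Var Δ σ} → vs {τ = τ} x ≡ vs y → x ≡ y
  vs-inj refl = refl

  inl-inj : ∀ {Δ : Ctx Sort} {σ} (Z : Ctx Sort) {x y : Var Δ σ} → inl Z x ≡ inl Z y → x ≡ y
  inl-inj ε e = e
  inl-inj (Z ▷ τ) e = inl-inj Z (vs-inj e)

  inr-inj : ∀ {Δ : Ctx Sort} {σ} (Z : Ctx Sort) {x y : Var Z σ} → inr {Δ = Δ} Z x ≡ inr Z y → x ≡ y
  inr-inj (Z ▷ τ) {vz} {vz} e = refl
  inr-inj (Z ▷ τ) {vz} {vs y} ()
  inr-inj (Z ▷ τ) {vs x} {vz} ()
  inr-inj (Z ▷ τ) {vs x} {vs y} e = cong vs (inr-inj Z (vs-inj e))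

  inl≢inr : ∀ {Δ : Ctx Sort} {σ} (Z : Ctx Sort) {x : Var Δ σ} {z : Var Z σ} → inl Z x ≡ inr Z z → ⊥
  inl≢inr (Z ▷ τ) {z = vz} ()
  inl≢inr (Z ▷ τ) {z = vs z} e = inl≢inr Z (vs-inj e)

  Injective : ∀ {Δ Δ' : Ctx Sort} → Ren Δ Δ' → Set
  Injective {Δ} ρ = ∀ {σ} {x y : Var Δ σ} → ρ x ≡ ρ y → x ≡ y

  liftR-inj : ∀ {Δ Δ' : Ctx Sort} {τ} {ρ : Ren Δ Δ'} → Injective ρ → Injective (liftR {τ = τ} ρ)
  liftR-inj i {x = vz} {vz} e = refl
  liftR-inj i {x = vz} {vs y} ()
  liftR-inj i {x = vs x} {vz} ()
  liftR-inj i {x = vs x} {vs y} e = cong vs (i (vs-inj e))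

  liftsR : ∀ {Δ Δ' : Ctx Sort} (Z : Ctx Sort) → Ren Δ Δ' → Ren (Δ ⧺ Z) (Δ' ⧺ Z)
  liftsR ε ρ = ρ
  liftsR (Z ▷ τ) ρ = liftR (liftsR Z ρ)

  liftsR-inj : ∀ {Δ Δ' : Ctx Sort} (Z : Ctx Sort) {ρ : Ren Δ Δ'} → Injective ρ →
               Injective (liftsR Z ρ)
  liftsR-inj ε i = i
  liftsR-inj (Z ▷ τ) i = liftR-inj (liftsR-inj Z i)

  liftsR-inl : ∀ {Δ Δ' : Ctx Sort} {σ} (Z : Ctx Sort) (ρ : Ren Δ Δ') (v : Var Δ σ) →
               liftsR Z ρ (inl Z v) ≡ inl Z (ρ v)
  liftsR-inl ε ρ v = refl
  liftsR-inl (Z ▷ τ) ρ v = cong vs (liftsR-inl Z ρ v)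

  assocR : ∀ {Δ : Ctx Sort} (W Z : Ctx Sort) → Ren ((Δ ⧺ W) ⧺ Z) (Δ ⧺ (W ⧺ Z))
  assocR W ε = λ v → v
  assocR W (Z ▷ τ) = liftR (assocR W Z)

  assocR-inl : ∀ {Δ : Ctx Sort} {σ} (W Z : Ctx Sort) (v : Var Δ σ) →
               assocR W Z (inl Z (inl W v)) ≡ inl (W ⧺ Z) v
  assocR-inl W ε v = refl
  assocR-inl W (Z ▷ τ) v = cong vs (assocR-inl W Z v)

  prepend : Ty Sort → Ctx Sort → Ctx Sort
  prepend σ Z = (ε ▷ σ) ⧺ Z

  shiftR : ∀ {Δ : Ctx Sort} {σ} (Z : Ctx Sort) → Ren ((Δ ▷ σ) ⧺ Z) (Δ ⧺ prepend σ Z)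
  shiftR ε = λ v → v
  shiftR (Z ▷ τ) = liftR (shiftR Z)

  shiftR-inl : ∀ {Δ : Ctx Sort} {σ ρ} (Z : Ctx Sort) (v : Var Δ ρ) →
               shiftR {σ = σ} Z (inl Z (vs v)) ≡ inl (prepend σ Z) v
  shiftR-inl ε v = refl
  shiftR-inl (Z ▷ τ) v = cong vs (shiftR-inl Z v)

  data SameNe {Γ : Ctx Sort} {σ a} (h : Head 𝔖 Γ σ) (ts : Sp 𝔖 Γ σ a) :
              ∀ {σ'} → Head 𝔖 Γ σ' → Sp 𝔖 Γ σ' a → Set where
    same-ne : ∀ {h' ts'} → h ≡ h' → ts ≡ ts' → SameNe h ts h' ts'

  ne-inj : ∀ {Γ : Ctx Sort} {σ σ' a} {h : Head 𝔖 Γ σ} {ts : Sp 𝔖 Γ σ a} {h' : Head 𝔖 Γ σ'}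
           {ts' : Sp 𝔖 Γ σ' a} →
           _≡_ {A = Nf 𝔖 Γ (ι a)} (ne h ts) (ne h' ts') → SameNe h ts h' ts'
  ne-inj refl = same-ne refl refl

  sub-ne-inj : ∀ {Γ Δ : Ctx Sort} {θ : PSub 𝔖 Γ Δ} {σ₁ σ₂ ρ₁ ρ₂ a} {h₁ : Head 𝔖 Γ σ₁}
               {H₁ : Head 𝔖 Δ ρ₁} {P₁ : PSp 𝔖 Δ ρ₁ σ₁} {h₂ : Head 𝔖 Γ σ₂} {H₂ : Head 𝔖 Δ ρ₂}
               {P₂ : PSp 𝔖 Δ ρ₂ σ₂} →
               HeadImage θ h₁ H₁ P₁ → HeadImage θ h₂ H₂ P₂ →
               (ts₁ : Sp 𝔖 Γ σ₁ a) (ts₂ : Sp 𝔖 Γ σ₂ a) → sub 𝔖 (ne h₁ ts₁) θ ≡ sub 𝔖 (ne h₂ ts₂) θ →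
               SameNe H₁ (P₁ ++ subSp 𝔖 ts₁ θ) H₂ (P₂ ++ subSp 𝔖 ts₂ θ)
  sub-ne-inj hi₁ hi₂ ts₁ ts₂ e = ne-inj (trans (sym (sub-ne hi₁ ts₁)) (trans e (sub-ne hi₂ ts₂)))

  var-inj : ∀ {Δ : Ctx Sort} {σ} {a b : Var Δ σ} → _≡_ {A = Head 𝔖 Δ σ} (var a) (var b) → a ≡ b
  var-inj refl = refl

  lam-inj : ∀ {Γ : Ctx Sort} {σ τ} {t t' : Nf 𝔖 (Γ ▷ σ) τ} → lam t ≡ lam t' → t ≡ t'
  lam-inj refl = refl

  ∷-inj : ∀ {Γ : Ctx Sort} {σ τ a} {t t' : Nf 𝔖 Γ σ} {ts ts' : Sp 𝔖 Γ τ a} →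
          _≡_ {A = Sp 𝔖 Γ (σ ⇒ τ) a} (t ∷ ts) (t' ∷ ts') → t ≡ t' × ts ≡ ts'
  ∷-inj refl = refl , refl

  data SameSnoc {Γ : Ctx Sort} {ρ σ τ} (ts : PSp 𝔖 Γ ρ (σ ⇒ τ)) (t : Nf 𝔖 Γ σ) :
                ∀ {σ'} → PSp 𝔖 Γ ρ (σ' ⇒ τ) → Nf 𝔖 Γ σ' → Set where
    same-snoc : ∀ {ts' t'} → ts ≡ ts' → t ≡ t' → SameSnoc ts t ts' t'

  ∷ʳ-inj : ∀ {Γ : Ctx Sort} {ρ σ σ' τ} {t : Nf 𝔖 Γ σ} {t' : Nf 𝔖 Γ σ'} {ts : PSp 𝔖 Γ ρ (σ ⇒ τ)}
           {ts' : PSp 𝔖 Γ ρ (σ' ⇒ τ)} →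
           _≡_ {A = PSp 𝔖 Γ ρ τ} (ts ∷ʳ t) (ts' ∷ʳ t') → SameSnoc ts t ts' t'
  ∷ʳ-inj refl = same-snoc refl refl

  renH-inj : ∀ {Γ Δ : Ctx Sort} {σ} {ρ : Ren Γ Δ} → Injective ρ → (h h' : Head 𝔖 Γ σ) →
             renH 𝔖 ρ h ≡ renH 𝔖 ρ h' → h ≡ h'
  renH-inj i (var x) (var y) e = cong var (i (var-inj e))
  renH-inj i (var x) (fun f) ()
  renH-inj i (fun f) (var y) ()
  renH-inj i (fun f) (fun g) e = cong fun (fun-inj e)
    where fun-inj : ∀ {a b} → _≡_ {A = Head 𝔖 _ _} (fun a) (fun b) → a ≡ b
          fun-inj refl = refl

  mutual
    ren-inj : ∀ {Γ Δ : Ctx Sort} {σ} {ρ : Ren Γ Δ} → Injective ρ → (t t' : Nf 𝔖 Γ σ) →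
              ren 𝔖 ρ t ≡ ren 𝔖 ρ t' → t ≡ t'
    ren-inj i (lam t) (lam t') e = cong lam (ren-inj (liftR-inj i) t t' (lam-inj e))
    ren-inj i (ne h ts) (ne h' ts') e with ne-inj e
    ... | same-ne eh ets with renH-inj i h h' eh
    ... | refl = cong (ne h) (renSp-inj i ts ts' ets)

    renSp-inj : ∀ {Γ Δ : Ctx Sort} {σ a} {ρ : Ren Γ Δ} → Injective ρ → (t t' : Sp 𝔖 Γ σ a) →
                renSp 𝔖 ρ t ≡ renSp 𝔖 ρ t' → t ≡ t'
    renSp-inj i [] [] e = refl
    renSp-inj i (t ∷ ts) (t' ∷ ts') e = cong₂ _∷_ (ren-inj i t t' (proj₁ (∷-inj e)))
        (renSp-inj i ts ts' (proj₂ (∷-inj e)))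

  renPS-inj : ∀ {Γ Δ : Ctx Sort} {σ τ} {ρ : Ren Γ Δ} → Injective ρ → (t t' : PSp 𝔖 Γ σ τ) →
              renPS 𝔖 ρ t ≡ renPS 𝔖 ρ t' → t ≡ t'
  renPS-inj i [] [] e = refl
  renPS-inj i [] (t' ∷ʳ x) ()
  renPS-inj i (t ∷ʳ x) [] ()
  renPS-inj i (t ∷ʳ x) (t' ∷ʳ x') e with ∷ʳ-inj e
  ... | same-snoc e1 e2 = cong₂ _∷ʳ_ (renPS-inj i t t' e1) (ren-inj i x x' e2)

module Occurrences (𝔖 : Signature) where
  open Signature 𝔖
  open Injectivity 𝔖 public

  _∈S_ : ∀ {Γ : Ctx Sort} {σ τ a} → Nf 𝔖 Γ σ → Sp 𝔖 Γ τ a → Set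
  s ∈S ts = _∈Sp_ 𝔖 s ts

  _∈F_ : ∀ {Γ : Ctx Sort} {σ τ} → Var Γ σ → Nf 𝔖 Γ τ → Set
  x ∈F t = _∈fv_ 𝔖 x t

  data _∈PS_ {Γ : Ctx Sort} {σ} (s : Nf 𝔖 Γ σ) : ∀ {ρ τ} → PSp 𝔖 Γ ρ τ → Set where
    hereᴾ : ∀ {ρ τ} {ps : PSp 𝔖 Γ ρ (σ ⇒ τ)} → s ∈PS (ps ∷ʳ s)
    thereᴾ : ∀ {ρ σ' τ} {ps : PSp 𝔖 Γ ρ (σ' ⇒ τ)} {t : Nf 𝔖 Γ σ'} → s ∈PS ps → s ∈PS (ps ∷ʳ t)

  ∈++-right : ∀ {Γ : Ctx Sort} {σ ρ τ a} {s : Nf 𝔖 Γ σ} (ps : PSp 𝔖 Γ ρ τ) {r : Sp 𝔖 Γ τ a} →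
              s ∈S r → s ∈S (ps ++ r)
  ∈++-right [] m = m
  ∈++-right (ps ∷ʳ t) m = ∈++-right ps (there m)

  ∈PS→∈++ : ∀ {Γ : Ctx Sort} {σ ρ τ a} {s : Nf 𝔖 Γ σ} {ps : PSp 𝔖 Γ ρ τ} (r : Sp 𝔖 Γ τ a) →
            s ∈PS ps → s ∈S (ps ++ r)
  ∈PS→∈++ {ps = ps ∷ʳ _} r hereᴾ = ∈++-right ps here
  ∈PS→∈++ {ps = ps ∷ʳ _} r (thereᴾ m) = ∈PS→∈++ _ m

  ∈++-split : ∀ {Γ : Ctx Sort} {σ ρ τ a} {s : Nf 𝔖 Γ σ} (ps : PSp 𝔖 Γ ρ τ) {r : Sp 𝔖 Γ τ a} →
              s ∈S (ps ++ r) → s ∈PS ps ⊎ s ∈S r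
  ∈++-split [] m = inj₂ m
  ∈++-split (ps ∷ʳ t) m with ∈++-split ps m
  ... | inj₁ m' = inj₁ (thereᴾ m')
  ... | inj₂ here = inj₁ hereᴾ
  ... | inj₂ (there m') = inj₂ m'

  ∈++ᴾ-left : ∀ {Γ : Ctx Sort} {σ ρ τ τ'} {s : Nf 𝔖 Γ σ} {P : PSp 𝔖 Γ ρ τ} (Q : PSp 𝔖 Γ τ τ') →
              s ∈PS P → s ∈PS (P ++ᴾ Q)
  ∈++ᴾ-left [] m = m
  ∈++ᴾ-left (Q ∷ʳ t) m = thereᴾ (∈++ᴾ-left Q m)

  ∈++ᴾ-right : ∀ {Γ : Ctx Sort} {σ ρ τ τ'} {s : Nf 𝔖 Γ σ} (P : PSp 𝔖 Γ ρ τ) {Q : PSp 𝔖 Γ τ τ'} →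
               s ∈PS Q → s ∈PS (P ++ᴾ Q)
  ∈++ᴾ-right P hereᴾ = hereᴾ
  ∈++ᴾ-right P (thereᴾ m) = thereᴾ (∈++ᴾ-right P m)

  ren-∈S : ∀ {Γ Δ : Ctx Sort} {σ τ a} (ρ : Ren Γ Δ) {s : Nf 𝔖 Γ σ} {ts : Sp 𝔖 Γ τ a} → s ∈S ts →
           ren 𝔖 ρ s ∈S renSp 𝔖 ρ ts
  ren-∈S ρ here = here
  ren-∈S ρ (there m) = there (ren-∈S ρ m)

  ren-∈PS : ∀ {Γ Δ : Ctx Sort} {σ τ τ'} (ρ : Ren Γ Δ) {s : Nf 𝔖 Γ σ} {ts : PSp 𝔖 Γ τ τ'} →
            s ∈PS ts → ren 𝔖 ρ s ∈PS renPS 𝔖 ρ ts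
  ren-∈PS ρ hereᴾ = hereᴾ
  ren-∈PS ρ (thereᴾ m) = thereᴾ (ren-∈PS ρ m)

  ∈S-ren-inv : ∀ {Γ Δ : Ctx Sort} {σ τ a} (ρ : Ren Γ Δ) {s : Nf 𝔖 Δ σ} (ts : Sp 𝔖 Γ τ a) →
               s ∈S renSp 𝔖 ρ ts → Σ (Nf 𝔖 Γ σ) λ s0 → s0 ∈S ts × s ≡ ren 𝔖 ρ s0
  ∈S-ren-inv ρ (t ∷ ts) here = t , here , refl
  ∈S-ren-inv ρ (t ∷ ts) (there m) with ∈S-ren-inv ρ ts m
  ... | s0 , m0 , e = s0 , there m0 , e

  ∈PS-ren-inv : ∀ {Γ Δ : Ctx Sort} {σ τ τ'} (ρ : Ren Γ Δ) {s : Nf 𝔖 Δ σ} (ts : PSp 𝔖 Γ τ τ') →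
                s ∈PS renPS 𝔖 ρ ts → Σ (Nf 𝔖 Γ σ) λ s0 → s0 ∈PS ts × s ≡ ren 𝔖 ρ s0
  ∈PS-ren-inv ρ (ts ∷ʳ t) hereᴾ = t , hereᴾ , refl
  ∈PS-ren-inv ρ (ts ∷ʳ t) (thereᴾ m) with ∈PS-ren-inv ρ ts m
  ... | s0 , m0 , e = s0 , thereᴾ m0 , e

  sub-∈S : ∀ {Γ Δ : Ctx Sort} {σ τ a} (θ : PSub 𝔖 Γ Δ) {s : Nf 𝔖 Γ σ} {ts : Sp 𝔖 Γ τ a} → s ∈S ts →
           sub 𝔖 s θ ∈S subSp 𝔖 ts θ
  sub-∈S θ here = here
  sub-∈S θ (there m) = there (sub-∈S θ m)

  sub-∈PS : ∀ {Γ Δ : Ctx Sort} {σ τ τ'} (θ : PSub 𝔖 Γ Δ) {s : Nf 𝔖 Γ σ} {ts : PSp 𝔖 Γ τ τ'} →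
            s ∈PS ts → sub 𝔖 s θ ∈PS subPS ts θ
  sub-∈PS θ hereᴾ = hereᴾ
  sub-∈PS θ (thereᴾ m) = thereᴾ (sub-∈PS θ m)

  ∈S-sub-inv : ∀ {Γ Δ : Ctx Sort} {σ τ a} (θ : PSub 𝔖 Γ Δ) {s : Nf 𝔖 Δ σ} (ts : Sp 𝔖 Γ τ a) →
               s ∈S subSp 𝔖 ts θ → Σ (Nf 𝔖 Γ σ) λ s0 → s0 ∈S ts × s ≡ sub 𝔖 s0 θ
  ∈S-sub-inv θ (t ∷ ts) here = t , here , refl
  ∈S-sub-inv θ (t ∷ ts) (there m) with ∈S-sub-inv θ ts m
  ... | s0 , m0 , e = s0 , there m0 , e

  ∈PS-sub-inv : ∀ {Γ Δ : Ctx Sort} {σ τ τ'} (θ : PSub 𝔖 Γ Δ) {s : Nf 𝔖 Δ σ} (ts : PSp 𝔖 Γ τ τ') →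
                s ∈PS subPS ts θ → Σ (Nf 𝔖 Γ σ) λ s0 → s0 ∈PS ts × s ≡ sub 𝔖 s0 θ
  ∈PS-sub-inv θ (ts ∷ʳ t) hereᴾ = t , hereᴾ , refl
  ∈PS-sub-inv θ (ts ∷ʳ t) (thereᴾ m) with ∈PS-sub-inv θ ts m
  ... | s0 , m0 , e = s0 , thereᴾ m0 , e

  -- Occ s Z t: t occurs in s below the binders Z. Unlike SubC, this keeps t open
  -- instead of closing it with lams.
  data Occ {Δ : Ctx Sort} {τ} (s : Nf 𝔖 Δ τ) : ∀ {τ'} (Z : Ctx Sort) → Nf 𝔖 (Δ ⧺ Z) τ' → Set where
    here : Occ s ε s
    olam : ∀ {Z σ τ'} {t : Nf 𝔖 ((Δ ⧺ Z) ▷ σ) τ'} → Occ s Z (lam t) → Occ s (Z ▷ σ) t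
    oarg : ∀ {Z ρ a σ} {h : Head 𝔖 (Δ ⧺ Z) ρ} {ts : Sp 𝔖 (Δ ⧺ Z) ρ a} {t : Nf 𝔖 (Δ ⧺ Z) σ} →
           Occ s Z (ne h ts) → t ∈S ts → Occ s Z t

  Occ-trans-ε : ∀ {Δ : Ctx Sort} {τ τ1 τ2} {s : Nf 𝔖 Δ τ} {s' : Nf 𝔖 Δ τ1} {Z}
                {t : Nf 𝔖 (Δ ⧺ Z) τ2} →
                Occ s ε s' → Occ s' Z t → Occ s Z t
  Occ-trans-ε o here = o
  Occ-trans-ε o (olam p) = olam (Occ-trans-ε o p)
  Occ-trans-ε o (oarg p m) = oarg (Occ-trans-ε o p) m

  Occ-trans : ∀ {Δ : Ctx Sort} {τ τ1 τ2} {s : Nf 𝔖 Δ τ} {W} {B : Nf 𝔖 (Δ ⧺ W) τ1} {Z}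
              {t : Nf 𝔖 ((Δ ⧺ W) ⧺ Z) τ2} →
              Occ s W B → Occ B Z t → Occ s (W ⧺ Z) (ren 𝔖 (assocR W Z) t)
  Occ-trans {B = B} o here = subst (Occ _ _) (sym (ren-id (λ v → refl) B)) o
  Occ-trans o (olam p) = olam (Occ-trans o p)
  Occ-trans {W = W} o (oarg {Z = Z} p m) = oarg (Occ-trans o p) (ren-∈S (assocR W Z) m)

  Occ-ren : ∀ {Δ Δ' : Ctx Sort} {τ τ'} (ρ : Ren Δ Δ') {s : Nf 𝔖 Δ τ} {Z} {t : Nf 𝔖 (Δ ⧺ Z) τ'} →
            Occ s Z t → Occ (ren 𝔖 ρ s) Z (ren 𝔖 (liftsR Z ρ) t)
  Occ-ren ρ here = here
  Occ-ren ρ (olam p) = olam (Occ-ren ρ p)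
  Occ-ren ρ (oarg {Z = Z} p m) = oarg (Occ-ren ρ p) (ren-∈S (liftsR Z ρ) m)

  Occ-ren-inv : ∀ {Δ Δ' : Ctx Sort} {τ τ'} (ρ : Ren Δ Δ') (s : Nf 𝔖 Δ τ) {Z}
                {M : Nf 𝔖 (Δ' ⧺ Z) τ'} →
                Occ (ren 𝔖 ρ s) Z M → Σ (Nf 𝔖 (Δ ⧺ Z) τ') λ M0 →
                Occ s Z M0 × M ≡ ren 𝔖 (liftsR Z ρ) M0
  Occ-ren-inv ρ s here = s , here , refl
  Occ-ren-inv ρ s (olam p) with Occ-ren-inv ρ s p
  ... | lam M0 , o , e = M0 , olam o , lam-inj e
  Occ-ren-inv ρ s (oarg {Z = Z} p m) with Occ-ren-inv ρ s p
  ... | ne h0 ts0 , o , e with ne-inj e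
  ... | same-ne eh refl with ∈S-ren-inv (liftsR Z ρ) ts0 m
  ... | c0 , m0 , e' = c0 , oarg o m0 , e'

  Occ-shift : ∀ {Δ : Ctx Sort} {σ τ τ'} {t0 : Nf 𝔖 (Δ ▷ σ) τ} {Z} {t : Nf 𝔖 ((Δ ▷ σ) ⧺ Z) τ'} →
              Occ t0 Z t → Occ (lam t0) (prepend σ Z) (ren 𝔖 (shiftR Z) t)
  Occ-shift {t0 = t0} here = subst (Occ _ _) (sym (ren-id (λ v → refl) t0)) (olam here)
  Occ-shift (olam p) = olam (Occ-shift p)
  Occ-shift (oarg {Z = Z} p m) = oarg (Occ-shift p) (ren-∈S (shiftR Z) m)

  -- Equality of terms whose types are not yet known to coincide.
  data _≃N_ {Γ : Ctx Sort} {τ} (p : Nf 𝔖 Γ τ) : ∀ {τ'} → Nf 𝔖 Γ τ' → Set where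
    nrefl : p ≃N p

  ≡⇒≃N : ∀ {Γ : Ctx Sort} {τ} {x y : Nf 𝔖 Γ τ} → x ≡ y → x ≃N y
  ≡⇒≃N refl = nrefl

  ≃N-trans : ∀ {Γ : Ctx Sort} {τ1 τ2 τ3} {x : Nf 𝔖 Γ τ1} {y : Nf 𝔖 Γ τ2} {z : Nf 𝔖 Γ τ3} → x ≃N y →
             y ≃N z → x ≃N z
  ≃N-trans nrefl q = q

  ≃N-ty : ∀ {Γ : Ctx Sort} {τ1 τ2} {x : Nf 𝔖 Γ τ1} {y : Nf 𝔖 Γ τ2} → x ≃N y → τ1 ≡ τ2
  ≃N-ty nrefl = refl

  ≃N-≡ : ∀ {Γ : Ctx Sort} {τ} {x y : Nf 𝔖 Γ τ} → x ≃N y → x ≡ y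
  ≃N-≡ nrefl = refl

  lams-≃N : ∀ {Γ : Ctx Sort} (A : Ctx Sort) {τ1 τ2} {p : Nf 𝔖 (Γ ⧺ A) τ1} {q : Nf 𝔖 (Γ ⧺ A) τ2} →
            p ≃N q → lams 𝔖 A p ≃N lams 𝔖 A q
  lams-≃N A nrefl = nrefl

  lam-lams-shift : ∀ {Δ : Ctx Sort} {σ τ} (Z : Ctx Sort) (t : Nf 𝔖 ((Δ ▷ σ) ⧺ Z) τ) →
                   lam (lams 𝔖 Z t) ≃N lams 𝔖 (prepend σ Z) (ren 𝔖 (shiftR Z) t)
  lam-lams-shift ε t = ≡⇒≃N (cong lam (sym (ren-id (λ v → refl) t)))
  lam-lams-shift (Z ▷ ρ) t = lam-lams-shift Z (lam t)

  lams-assocR : ∀ {Γ : Ctx Sort} (A Z : Ctx Sort) {τ} (t : Nf 𝔖 ((Γ ⧺ A) ⧺ Z) τ) →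
                lams 𝔖 (A ⧺ Z) (ren 𝔖 (assocR A Z) t) ≃N lams 𝔖 A (lams 𝔖 Z t)
  lams-assocR A ε t = ≡⇒≃N (cong (lams 𝔖 A) (ren-id (λ v → refl) t))
  lams-assocR A (Z ▷ σ) t = lams-assocR A Z (lam t)

  unlam : ∀ {Γ : Ctx Sort} {σ τ} → Nf 𝔖 Γ (σ ⇒ τ) → Nf 𝔖 (Γ ▷ σ) τ
  unlam (lam t) = t

  unlams : ∀ {Γ : Ctx Sort} {τ} (Z : Ctx Sort) → Nf 𝔖 Γ (Z ⇒* τ) → Nf 𝔖 (Γ ⧺ Z) τ
  unlams ε t = t
  unlams (Z ▷ σ) t = unlam (unlams Z t)

  unlams-lams : ∀ {Γ : Ctx Sort} {τ} (Z : Ctx Sort) (t : Nf 𝔖 (Γ ⧺ Z) τ) → unlams Z (lams 𝔖 Z t) ≡ t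
  unlams-lams ε t = refl
  unlams-lams (Z ▷ σ) t rewrite unlams-lams Z (lam t) = refl

  lams-inj : ∀ {Γ : Ctx Sort} {τ} (Z : Ctx Sort) {t t' : Nf 𝔖 (Γ ⧺ Z) τ} →
             lams 𝔖 Z t ≡ lams 𝔖 Z t' → t ≡ t'
  lams-inj Z {t} {t'} e = trans (sym (unlams-lams Z t))
      (trans (cong (unlams Z) e) (unlams-lams Z t'))

  ⇒*-cancel : (A : Ctx Sort) {τ1 τ2 : Ty Sort} → A ⇒* τ1 ≡ A ⇒* τ2 → τ1 ≡ τ2
  ⇒*-cancel ε e = e
  ⇒*-cancel (A ▷ σ) e with ⇒*-cancel A e
  ... | refl = refl

  binders : Ctx Sort → Ty Sort → Ctx Sort
  binders acc (ι a) = acc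
  binders acc (σ ⇒ τ) = binders (acc ▷ σ) τ

  binders-⇒* : (acc Z : Ctx Sort) (τ : Ty Sort) → binders acc (Z ⇒* τ) ≡ binders (acc ⧺ Z) τ
  binders-⇒* acc ε τ = refl
  binders-⇒* acc (Z ▷ σ) τ = binders-⇒* acc Z (σ ⇒ τ)

  ε⧺ : (Z : Ctx Sort) → (ε ⧺ Z) ≡ Z
  ε⧺ ε = refl
  ε⧺ (Z ▷ σ) = cong (_▷ σ) (ε⧺ Z)

  target : Ty Sort → Sort
  target (ι a) = a
  target (σ ⇒ τ) = target τ

  target-⇒* : (Z : Ctx Sort) (τ : Ty Sort) → target (Z ⇒* τ) ≡ target τ
  target-⇒* ε τ = refl
  target-⇒* (Z ▷ σ) τ = target-⇒* Z (σ ⇒ τ)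

  ⇒*-inj : (Z Z' : Ctx Sort) (a a' : Sort) → Z ⇒* ι a ≡ Z' ⇒* ι a' → Z ≡ Z' × a ≡ a'
  ⇒*-inj Z Z' a a' e =
    trans (sym (ε⧺ Z))
        (trans (sym (binders-⇒* ε Z (ι a)))
        (trans (cong (binders ε) e) (trans (binders-⇒* ε Z' (ι a')) (ε⧺ Z')))) ,
    trans (sym (target-⇒* Z (ι a))) (trans (cong target e) (target-⇒* Z' (ι a')))

  SubC-lams : ∀ {Γ : Ctx Sort} (A : Ctx Sort) {τ τ'} {s : Nf 𝔖 (Γ ⧺ A) τ} {u : Nf 𝔖 Γ τ'} →
              SubC 𝔖 A s u → SubC 𝔖 ε (lams 𝔖 A s) u
  SubC-lams ε p = p
  SubC-lams (A ▷ σ) p = SubC-lams A (lam p)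

  SubC-unlams : ∀ {Γ : Ctx Sort} (A : Ctx Sort) {τ τ'} {s : Nf 𝔖 (Γ ⧺ A) τ} {u : Nf 𝔖 Γ τ'} →
                SubC 𝔖 ε (lams 𝔖 A s) u → SubC 𝔖 A s u
  SubC-unlams ε p = p
  SubC-unlams (A ▷ σ) p with SubC-unlams A p
  ... | here = here
  ... | lam q = q

  Occ-SubC : ∀ {Γ : Ctx Sort} {A : Ctx Sort} {τ τ' τ''} {s : Nf 𝔖 (Γ ⧺ A) τ} {Z}
             {t : Nf 𝔖 ((Γ ⧺ A) ⧺ Z) τ'} {u : Nf 𝔖 Γ τ''} →
             Occ s Z t → SubC 𝔖 (A ⧺ Z) (ren 𝔖 (assocR A Z) t) u → SubC 𝔖 A s u
  Occ-SubC {s = s} here q = subst (λ w → SubC 𝔖 _ w _) (ren-id (λ v → refl) s) q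
  Occ-SubC (olam o) q = Occ-SubC o (lam q)
  Occ-SubC {A = A} (oarg {Z = Z} o m) q = Occ-SubC o (arg (ren-∈S (assocR A Z) m) q)

  SubC-≃N : ∀ {Γ : Ctx Sort} {A : Ctx Sort} {τ τ1 τ2} {s : Nf 𝔖 (Γ ⧺ A) τ} {u1 : Nf 𝔖 Γ τ1}
            {u2 : Nf 𝔖 Γ τ2} →
            u1 ≃N u2 → SubC 𝔖 A s u1 → SubC 𝔖 A s u2
  SubC-≃N nrefl p = p

  Occ⇒⊵ : ∀ {Γ : Ctx Sort} (A : Ctx Sort) {τ τ'} {s : Nf 𝔖 (Γ ⧺ A) τ} {Z}
          {t : Nf 𝔖 ((Γ ⧺ A) ⧺ Z) τ'} →
          Occ s Z t → _⊵_ 𝔖 (lams 𝔖 A s) (lams 𝔖 A (lams 𝔖 Z t))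
  Occ⇒⊵ A {Z = Z} {t} o = SubC-lams A (SubC-≃N (lams-assocR A Z t) (Occ-SubC o here))

  SubC⇒Occ : ∀ {Γ : Ctx Sort} {A : Ctx Sort} {τ τ'} {s : Nf 𝔖 (Γ ⧺ A) τ} {u : Nf 𝔖 Γ τ'} →
             SubC 𝔖 A s u → Σ (Ctx Sort) λ Z → Σ (Ty Sort) λ τ2 → Σ (Nf 𝔖 ((Γ ⧺ A) ⧺ Z) τ2) λ t →
             Occ s Z t × u ≃N lams 𝔖 A (lams 𝔖 Z t)
  SubC⇒Occ {s = s} here = ε , _ , s , here , nrefl
  SubC⇒Occ {A = A} (lam {σ = σ} p) with SubC⇒Occ p
  ... | Z , τ2 , t , o , e = prepend σ Z , τ2 , ren 𝔖 (shiftR Z) t , Occ-shift o , ≃N-trans e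
      (lams-≃N A (lam-lams-shift Z t))
  SubC⇒Occ (arg m p) with SubC⇒Occ p
  ... | Z , τ2 , t , o , e = Z , τ2 , t , Occ-trans-ε (oarg here m) o , e

  Occ-extract : ∀ {Δ : Ctx Sort} {τ τ'} {s : Nf 𝔖 Δ τ} {Z X' : Ctx Sort} {a} (t : Nf 𝔖 (Δ ⧺ Z) τ')
                {n : Nf 𝔖 (Δ ⧺ X') (ι a)} →
                Occ s Z t → lams 𝔖 X' n ≃N lams 𝔖 Z t → Occ s X' n
  Occ-extract (lam t) o e = Occ-extract t (olam o) e
  Occ-extract {Z = Z} {X'} {a} (ne {a = c} h ts) {n} o e with ⇒*-inj X' Z a c (≃N-ty e)
  ... | refl , refl = subst (Occ _ _) (sym (lams-inj Z (≃N-≡ e))) o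

  lams-≃-inj' : ∀ {Γ : Ctx Sort} (A : Ctx Sort) {τ1 τ2} {p : Nf 𝔖 (Γ ⧺ A) τ1}
                {q : Nf 𝔖 (Γ ⧺ A) τ2} →
                τ1 ≡ τ2 → lams 𝔖 A p ≃N lams 𝔖 A q → p ≃N q
  lams-≃-inj' A refl e = ≡⇒≃N (lams-inj A (≃N-≡ e))

  lams-≃-inj : ∀ {Γ : Ctx Sort} (A : Ctx Sort) {τ1 τ2} {p : Nf 𝔖 (Γ ⧺ A) τ1} {q : Nf 𝔖 (Γ ⧺ A) τ2} →
               lams 𝔖 A p ≃N lams 𝔖 A q → p ≃N q
  lams-≃-inj A e = lams-≃-inj' A (⇒*-cancel A (≃N-ty e)) e

  ⊵⇒Occ : ∀ {Γ : Ctx Sort} (A : Ctx Sort) {τ} {s : Nf 𝔖 (Γ ⧺ A) τ} {X' : Ctx Sort} {a}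
          {n : Nf 𝔖 ((Γ ⧺ A) ⧺ X') (ι a)} →
          _⊵_ 𝔖 (lams 𝔖 A s) (lams 𝔖 A (lams 𝔖 X' n)) → Occ s X' n
  ⊵⇒Occ A {X' = X'} {n = n} p with SubC⇒Occ (SubC-unlams A p)
  ... | Z , τ2 , t , o , e = Occ-extract t o (lams-≃-inj A e)

  mutual
    fv-ren : ∀ {Γ Δ : Ctx Sort} {σ τ} (ρ : Ren Γ Δ) {v : Var Γ σ} {t : Nf 𝔖 Γ τ} → v ∈F t →
             ρ v ∈F ren 𝔖 ρ t
    fv-ren ρ (lam p) = lam (fv-ren (liftR ρ) p)
    fv-ren ρ head = head
    fv-ren ρ (arg m p) = arg (ren-∈S ρ m) (fv-ren ρ p)

  data HeadVar {Γ : Ctx Sort} : ∀ {ρ σ} → Head 𝔖 Γ ρ → Var Γ σ → Set where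
    head-var : ∀ {σ} {v : Var Γ σ} → HeadVar (var v) v

  mutual
    fv-ren-inv : ∀ {Γ Δ : Ctx Sort} {σ τ} (ρ : Ren Γ Δ) {x : Var Δ σ} (t : Nf 𝔖 Γ τ) →
                 x ∈F ren 𝔖 ρ t → Σ (Var Γ σ) λ v → ρ v ≡ x × v ∈F t
    fv-ren-inv ρ (lam t) (lam p) with fv-ren-inv (liftR ρ) t p
    ... | vz , () , q
    ... | vs v , e , q = v , vs-inj e , lam q
    fv-ren-inv ρ (ne (var w) ts) head = w , refl , head
    fv-ren-inv ρ (ne h ts) (arg m p) with fvSp-ren-inv ρ ts m p
    ... | v , e , s0 , m0 , q = v , e , arg m0 q

    fvSp-ren-inv : ∀ {Γ Δ : Ctx Sort} {σ σ' τ a} (ρ : Ren Γ Δ) {x : Var Δ σ} (ts : Sp 𝔖 Γ τ a)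
                   {s : Nf 𝔖 Δ σ'} →
                   s ∈S renSp 𝔖 ρ ts → x ∈F s → Σ (Var Γ σ) λ v → ρ v ≡ x × Σ (Nf 𝔖 Γ σ') λ s0 →
                   s0 ∈S ts × v ∈F s0
    fvSp-ren-inv ρ (t ∷ ts) here p with fv-ren-inv ρ t p
    ... | v , e , q = v , e , t , here , q
    fvSp-ren-inv ρ (t ∷ ts) (there m) p with fvSp-ren-inv ρ ts m p
    ... | v , e , s0 , m0 , q = v , e , s0 , there m0 , q

  Occ-fv : ∀ {Δ : Ctx Sort} {τ τ' σ} {s : Nf 𝔖 Δ τ} {Z} {t : Nf 𝔖 (Δ ⧺ Z) τ'} → Occ s Z t →
           (v : Var Δ σ) → inl Z v ∈F t → v ∈F s
  Occ-fv here v p = p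
  Occ-fv (olam o) v p = Occ-fv o v (lam p)
  Occ-fv (oarg o m) v p = Occ-fv o v (arg m p)

  fv-expand-head : ∀ {Γ : Ctx Sort} {ρ} (τ : Ty Sort) (v : Var Γ ρ) (ps : PSp 𝔖 Γ ρ τ) →
                   v ∈F expand 𝔖 τ (var v) ps
  fv-expand-head (ι a) v ps = head
  fv-expand-head (σ ⇒ τ) v ps = lam (fv-expand-head τ (vs v) _)

  fv-expand-arg : ∀ {Γ : Ctx Sort} {ρ σ σ'} (τ : Ty Sort) (h : Head 𝔖 Γ ρ) {ps : PSp 𝔖 Γ ρ τ}
                  {b : Nf 𝔖 Γ σ'} {v : Var Γ σ} →
                  b ∈PS ps → v ∈F b → v ∈F expand 𝔖 τ h ps
  fv-expand-arg (ι a) h m p = arg (∈PS→∈++ [] m) p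
  fv-expand-arg (σ ⇒ τ) h m p =
    lam (fv-expand-arg τ (renH 𝔖 vs h) (thereᴾ (ren-∈PS vs m)) (fv-ren vs p))

  fv-expand-inv : ∀ {Γ : Ctx Sort} {ρ σ} (τ : Ty Sort) (h : Head 𝔖 Γ ρ) (ps : PSp 𝔖 Γ ρ τ)
                  {v : Var Γ σ} →
                  v ∈F expand 𝔖 τ h ps → HeadVar h v ⊎ Σ (Ty Sort) λ σ' → Σ (Nf 𝔖 Γ σ') λ b →
                  b ∈PS ps × v ∈F b
  fv-expand-inv (ι a) (var w) ps head = inj₁ head-var
  fv-expand-inv (ι a) h ps (arg m p) with ∈++-split ps m
  ... | inj₁ m' = inj₂ (_ , _ , m' , p)
  ... | inj₂ ()
  fv-expand-inv (σ ⇒ τ) h ps (lam p) with fv-expand-inv τ (renH 𝔖 vs h)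
      (renPS 𝔖 vs ps ∷ʳ expand 𝔖 σ (var vz) []) p
  fv-expand-inv (σ ⇒ τ) (var w) ps (lam p) | inj₁ head-var = inj₁ head-var
  fv-expand-inv (σ ⇒ τ) h ps (lam p) | inj₂ (σ' , b , hereᴾ , q) with fv-expand-inv σ (var vz) [] q
  ... | inj₁ ()
  ... | inj₂ (_ , _ , () , _)
  fv-expand-inv (σ ⇒ τ) h ps (lam p) | inj₂ (σ' , b , thereᴾ m , q) with ∈PS-ren-inv vs ps m
  ... | b0 , m0 , refl with fv-ren-inv vs b0 q
  ... | w , e , q' with vs-inj e
  ... | refl = inj₂ (σ' , b0 , m0 , q')

module Spines (𝔖 : Signature) where
  open Signature 𝔖
  open Occurrences 𝔖 public

  ++-cancelˡ : ∀ {Γ : Ctx Sort} {ρ τ a} (ps : PSp 𝔖 Γ ρ τ) {r r' : Sp 𝔖 Γ τ a} →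
               ps ++ r ≡ ps ++ r' → r ≡ r'
  ++-cancelˡ [] e = e
  ++-cancelˡ (ps ∷ʳ t) e = proj₂ (∷-inj (++-cancelˡ ps e))

  renSp-split : ∀ {Γ Δ : Ctx Sort} {σ τ a} {ρ : Ren Γ Δ} → Injective ρ →
                (sp : Sp 𝔖 Γ σ a) (ps : PSp 𝔖 Γ σ τ) {r : Sp 𝔖 Δ τ a} →
                renSp 𝔖 ρ sp ≡ renPS 𝔖 ρ ps ++ r → Σ (Sp 𝔖 Γ τ a) λ r0 →
                sp ≡ ps ++ r0 × renSp 𝔖 ρ r0 ≡ r
  renSp-split i sp [] e = sp , refl , e
  renSp-split i sp (ps ∷ʳ t) e with renSp-split i sp ps e
  ... | c ∷ r0 , e1 , e2 with ∷-inj e2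
  ... | e3 , e4 with ren-inj i c t e3
  ... | refl = r0 , e1 , e4

  subSp-split : ∀ {Γ Δ : Ctx Sort} {σ τ a} (θ : PSub 𝔖 Γ Δ) (sp : Sp 𝔖 Γ σ a) (P : PSp 𝔖 Δ σ τ)
                {r : Sp 𝔖 Δ τ a} →
                subSp 𝔖 sp θ ≡ P ++ r → Σ (PSp 𝔖 Γ σ τ) λ pre → Σ (Sp 𝔖 Γ τ a) λ post →
                sp ≡ pre ++ post × subPS pre θ ≡ P × subSp 𝔖 post θ ≡ r
  subSp-split θ sp [] e = [] , sp , refl , refl , e
  subSp-split θ sp (P ∷ʳ t) e with subSp-split θ sp P e
  ... | pre , c ∷ post , e1 , e2 , e3 with ∷-inj e3
  ... | e4 , e5 = pre ∷ʳ c , post , e1 , cong₂ _∷ʳ_ e2 e4 , e5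

  -- Prefixes of partial spines are compared on their cons-list form.
  data FwdSp (Γ : Ctx Sort) : Ty Sort → Ty Sort → Set where
    f[] : ∀ {ρ} → FwdSp Γ ρ ρ
    _f∷_ : ∀ {σ τ τ'} → Nf 𝔖 Γ σ → FwdSp Γ τ τ' → FwdSp Γ (σ ⇒ τ) τ'

  infixr 5 _f∷_

  _+F_ : ∀ {Γ ρ τ a} → FwdSp Γ ρ τ → Sp 𝔖 Γ τ a → Sp 𝔖 Γ ρ a
  f[] +F r = r
  (t f∷ f) +F r = t ∷ (f +F r)

  _++F_ : ∀ {Γ ρ τ τ'} → FwdSp Γ ρ τ → FwdSp Γ τ τ' → FwdSp Γ ρ τ'
  f[] ++F g = g
  (t f∷ f) ++F g = t f∷ (f ++F g)

  +F-assoc : ∀ {Γ ρ τ τ' a} (f : FwdSp Γ ρ τ) (g : FwdSp Γ τ τ') (r : Sp 𝔖 Γ τ' a) →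
             (f ++F g) +F r ≡ f +F (g +F r)
  +F-assoc f[] g r = refl
  +F-assoc (t f∷ f) g r = cong (t ∷_) (+F-assoc f g r)

  toF : ∀ {Γ ρ τ} → PSp 𝔖 Γ ρ τ → FwdSp Γ ρ τ
  toF [] = f[]
  toF (ps ∷ʳ t) = toF ps ++F (t f∷ f[])

  toF-++ : ∀ {Γ ρ τ a} (ps : PSp 𝔖 Γ ρ τ) (r : Sp 𝔖 Γ τ a) → ps ++ r ≡ toF ps +F r
  toF-++ [] r = refl
  toF-++ (ps ∷ʳ t) r = trans (toF-++ ps (t ∷ r)) (sym (+F-assoc (toF ps) (t f∷ f[]) r))

  renF : ∀ {Γ Δ ρ τ} → Ren Γ Δ → FwdSp Γ ρ τ → FwdSp Δ ρ τ
  renF ρ f[] = f[]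
  renF ρ (t f∷ f) = ren 𝔖 ρ t f∷ renF ρ f

  renF-++ : ∀ {Γ Δ ρ τ τ'} (κ : Ren Γ Δ) (f : FwdSp Γ ρ τ) (g : FwdSp Γ τ τ') →
            renF κ (f ++F g) ≡ renF κ f ++F renF κ g
  renF-++ κ f[] g = refl
  renF-++ κ (t f∷ f) g = cong (_ f∷_) (renF-++ κ f g)

  toF-ren : ∀ {Γ Δ ρ τ} (κ : Ren Γ Δ) (ps : PSp 𝔖 Γ ρ τ) → toF (renPS 𝔖 κ ps) ≡ renF κ (toF ps)
  toF-ren κ [] = refl
  toF-ren κ (ps ∷ʳ t) = trans (cong (_++F (ren 𝔖 κ t f∷ f[])) (toF-ren κ ps))
      (sym (renF-++ κ (toF ps) (t f∷ f[])))

  FwdSp-comparable : ∀ {Γ Δ : Ctx Sort} {ρ τ1 τ2 a} {κ : Ren Γ Δ} → Injective κ →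
                     (f1 : FwdSp Γ ρ τ1) (f2 : FwdSp Γ ρ τ2) {r1 : Sp 𝔖 Δ τ1 a} {r2 : Sp 𝔖 Δ τ2 a} →
                     renF κ f1 +F r1 ≡ renF κ f2 +F r2 →
                     (Σ (FwdSp Γ τ1 τ2) λ e → f2 ≡ f1 ++F e) ⊎
                       (Σ (FwdSp Γ τ2 τ1) λ e → f1 ≡ f2 ++F e)
  FwdSp-comparable i f[] f2 e = inj₁ (f2 , refl)
  FwdSp-comparable i (t f∷ f1) f[] e = inj₂ (t f∷ f1 , refl)
  FwdSp-comparable i (t f∷ f1) (t2 f∷ f2) e with ∷-inj e
  ... | e1 , e2 with ren-inj i t t2 e1 | FwdSp-comparable i f1 f2 e2
  ... | refl | inj₁ (g , eg) = inj₁ (g , cong (t f∷_) eg)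
  ... | refl | inj₂ (g , eg) = inj₂ (g , cong (t f∷_) eg)

  Prefix : ∀ {Γ : Ctx Sort} {ρ τ1 τ2} → PSp 𝔖 Γ ρ τ1 → PSp 𝔖 Γ ρ τ2 → Set
  Prefix {Γ} {ρ} {τ1} {τ2} b1 b2 = Σ (FwdSp Γ τ1 τ2) λ e → toF b2 ≡ toF b1 ++F e

  Prefix-comparable : ∀ {Γ Δ : Ctx Sort} {ρ τ1 τ2 a} {κ : Ren Γ Δ} → Injective κ →
                      (b1 : PSp 𝔖 Γ ρ τ1) (b2 : PSp 𝔖 Γ ρ τ2) {r1 : Sp 𝔖 Δ τ1 a}
                        {r2 : Sp 𝔖 Δ τ2 a} →
                      renPS 𝔖 κ b1 ++ r1 ≡ renPS 𝔖 κ b2 ++ r2 → Prefix b1 b2 ⊎ Prefix b2 b1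
  Prefix-comparable {κ = κ} i b1 b2 {r1} {r2} e =
    FwdSp-comparable i (toF b1) (toF b2)
      (trans (cong (_+F r1) (sym (toF-ren κ b1)))
        (trans (sym (toF-++ (renPS 𝔖 κ b1) r1))
            (trans e (trans (toF-++ (renPS 𝔖 κ b2) r2) (cong (_+F r2) (toF-ren κ b2))))))

  Prefix-++ : ∀ {Γ Δ : Ctx Sort} {ρ τ1 τ2 a} {b1 : PSp 𝔖 Γ ρ τ1} {b2 : PSp 𝔖 Γ ρ τ2} →
              Prefix b1 b2 → (κ : Ren Γ Δ) (r : Sp 𝔖 Δ τ2 a) → Σ (Sp 𝔖 Δ τ1 a) λ r' →
              renPS 𝔖 κ b2 ++ r ≡ renPS 𝔖 κ b1 ++ r'
  Prefix-++ {b1 = b1} {b2} (g , eg) κ r =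
    renF κ g +F r ,
    trans (toF-++ (renPS 𝔖 κ b2) r)
     (trans (cong (_+F r) (trans (toF-ren κ b2) (trans (cong (renF κ) eg) (renF-++ κ (toF b1) g))))
      (trans (+F-assoc (renF κ (toF b1)) (renF κ g) r)
       (trans (cong (_+F (renF κ g +F r)) (sym (toF-ren κ b1))) (sym (toF-++ (renPS 𝔖 κ b1) _)))))

  data _∈FF_ {Γ : Ctx Sort} {σ} (s : Nf 𝔖 Γ σ) : ∀ {ρ τ} → FwdSp Γ ρ τ → Set where
    fh : ∀ {τ τ'} {f : FwdSp Γ τ τ'} → s ∈FF (s f∷ f)
    ft : ∀ {σ' τ τ'} {t : Nf 𝔖 Γ σ'} {f : FwdSp Γ τ τ'} → s ∈FF f → s ∈FF (t f∷ f)

  ∈FF-l : ∀ {Γ : Ctx Sort} {σ ρ τ τ'} {s : Nf 𝔖 Γ σ} {f : FwdSp Γ ρ τ} (g : FwdSp Γ τ τ') →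
          s ∈FF f → s ∈FF (f ++F g)
  ∈FF-l g fh = fh
  ∈FF-l g (ft m) = ft (∈FF-l g m)

  ∈FF-r : ∀ {Γ : Ctx Sort} {σ ρ τ τ'} {s : Nf 𝔖 Γ σ} (f : FwdSp Γ ρ τ) {g : FwdSp Γ τ τ'} →
          s ∈FF g → s ∈FF (f ++F g)
  ∈FF-r f[] m = m
  ∈FF-r (t f∷ f) m = ft (∈FF-r f m)

  ∈FF-split : ∀ {Γ : Ctx Sort} {σ ρ τ τ'} {s : Nf 𝔖 Γ σ} (f : FwdSp Γ ρ τ) {g : FwdSp Γ τ τ'} →
              s ∈FF (f ++F g) → s ∈FF f ⊎ s ∈FF g
  ∈FF-split f[] m = inj₂ m
  ∈FF-split (t f∷ f) fh = inj₁ fh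
  ∈FF-split (t f∷ f) (ft m) with ∈FF-split f m
  ... | inj₁ m' = inj₁ (ft m')
  ... | inj₂ m' = inj₂ m'

  ∈PS→FF : ∀ {Γ : Ctx Sort} {σ ρ τ} {s : Nf 𝔖 Γ σ} {ps : PSp 𝔖 Γ ρ τ} → s ∈PS ps → s ∈FF toF ps
  ∈PS→FF {ps = ps ∷ʳ t} hereᴾ = ∈FF-r (toF ps) fh
  ∈PS→FF (thereᴾ m) = ∈FF-l _ (∈PS→FF m)

  ∈FF→PS : ∀ {Γ : Ctx Sort} {σ ρ τ} {s : Nf 𝔖 Γ σ} (ps : PSp 𝔖 Γ ρ τ) → s ∈FF toF ps → s ∈PS ps
  ∈FF→PS [] ()
  ∈FF→PS (ps ∷ʳ t) m with ∈FF-split (toF ps) m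
  ... | inj₁ m' = thereᴾ (∈FF→PS ps m')
  ... | inj₂ fh = hereᴾ

  Prefix-∈ : ∀ {Γ : Ctx Sort} {ρ τ1 τ2 σ} {b1 : PSp 𝔖 Γ ρ τ1} {b2 : PSp 𝔖 Γ ρ τ2} → Prefix b1 b2 →
             {s : Nf 𝔖 Γ σ} → s ∈PS b1 → s ∈PS b2
  Prefix-∈ {b2 = b2} (g , eg) m = ∈FF→PS b2 (subst (_ ∈FF_) (sym eg) (∈FF-l g (∈PS→FF m)))

  []++ᴾ : ∀ {Γ : Ctx Sort} {ρ τ} (ps : PSp 𝔖 Γ ρ τ) → ([] ++ᴾ ps) ≡ ps
  []++ᴾ [] = refl
  []++ᴾ (ps ∷ʳ t) = cong (_∷ʳ t) ([]++ᴾ ps)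

  snocAll : ∀ {Γ : Ctx Sort} {ρ τ a} → PSp 𝔖 Γ ρ τ → Sp 𝔖 Γ τ a → PSp 𝔖 Γ ρ (ι a)
  snocAll acc [] = acc
  snocAll acc (t ∷ sp) = snocAll (acc ∷ʳ t) sp

  snocAll-++ : ∀ {Γ : Ctx Sort} {ρ τ τ' a} (acc : PSp 𝔖 Γ ρ τ) (ps : PSp 𝔖 Γ τ τ')
               (r : Sp 𝔖 Γ τ' a) →
               snocAll acc (ps ++ r) ≡ snocAll (acc ++ᴾ ps) r
  snocAll-++ acc [] r = refl
  snocAll-++ acc (ps ∷ʳ t) r = snocAll-++ acc ps (t ∷ r)

  ++[]-injective : ∀ {Γ : Ctx Sort} {ρ a} (ps ps' : PSp 𝔖 Γ ρ (ι a)) → ps ++ [] ≡ ps' ++ [] →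
                   ps ≡ ps'
  ++[]-injective ps ps' e =
    trans (sym ([]++ᴾ ps))
        (trans (sym (snocAll-++ [] ps []))
        (trans (cong (snocAll []) e) (trans (snocAll-++ [] ps' []) ([]++ᴾ ps'))))

  SameHeadArgs : ∀ {Γ : Ctx Sort} {ρ ρ' τ} → ρ ≡ ρ' → Head 𝔖 Γ ρ → PSp 𝔖 Γ ρ τ → Head 𝔖 Γ ρ' →
                 PSp 𝔖 Γ ρ' τ → Set
  SameHeadArgs refl h ps h' ps' = h ≡ h' × ps ≡ ps'

  expand-inj : ∀ {Γ : Ctx Sort} {ρ ρ'} (τ : Ty Sort) (h : Head 𝔖 Γ ρ) (ps : PSp 𝔖 Γ ρ τ)
               (h' : Head 𝔖 Γ ρ') (ps' : PSp 𝔖 Γ ρ' τ) →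
               expand 𝔖 τ h ps ≡ expand 𝔖 τ h' ps' → Σ (ρ ≡ ρ') λ e → SameHeadArgs e h ps h' ps'
  expand-inj (ι a) h ps h' ps' e with ne-inj e
  ... | same-ne refl ets = refl , refl , ++[]-injective ps ps' ets
  expand-inj (σ ⇒ τ) h ps h' ps' e with expand-inj τ _ _ _ _ (lam-inj e)
  ... | refl , eh , eps with ∷ʳ-inj eps
  ... | same-snoc e1 e2 = refl , renH-inj vs-inj h h' eh , renPS-inj vs-inj ps ps' e1

  expand-body : ∀ {Γ : Ctx Sort} {ρ} (τ : Ty Sort) (h : Head 𝔖 Γ ρ) (ps : PSp 𝔖 Γ ρ τ) →
                Σ (Ctx Sort) λ W → Σ Sort λ a → Σ (Nf 𝔖 (Γ ⧺ W) (ι a)) λ B →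
                Occ (expand 𝔖 τ h ps) W B × Σ (Sp 𝔖 (Γ ⧺ W) τ a) λ r →
                B ≡ ne (renH 𝔖 (inl W) h) (renPS 𝔖 (inl W) ps ++ r)
  expand-body (ι a) h ps = ε , a , _ , here , [] , cong₂ (λ x y → ne x (y ++ []))
      (sym (renH-id (λ v → refl) h)) (sym (renPS-id (λ v → refl) ps))
  expand-body {ρ = ρ} (σ ⇒ τ) h ps with expand-body τ (renH 𝔖 vs h)
      (renPS 𝔖 vs ps ∷ʳ expand 𝔖 σ (var vz) [])
  ... | W , a , B , o , r , e =
    prepend σ W , a , ren 𝔖 (shiftR W) B , Occ-shift o ,
    ren 𝔖 (liftsR ε (shiftR W)) (ren 𝔖 (inl W) (expand 𝔖 σ (var vz) [])) ∷ renSp 𝔖 (shiftR W) r ,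
    trans (cong (ren 𝔖 (shiftR W)) e)
      (cong₂ ne (trans (cong (renH 𝔖 (shiftR W)) (renH-∘ (λ v → refl) h))
          (renH-∘ (λ v → shiftR-inl W v) h))
        (trans (renSp-++ (shiftR W) (renPS 𝔖 (inl W) (renPS 𝔖 vs ps ∷ʳ expand 𝔖 σ (var vz) [])) r)
          (cong (λ q → q ++ _)
              (trans (cong (renPS 𝔖 (shiftR W)) (renPS-∘ (λ v → refl) ps))
              (renPS-∘ (λ v → shiftR-inl W v) ps)))))

  mutual
    size : ∀ {Γ : Ctx Sort} {τ} → Nf 𝔖 Γ τ → ℕ
    size (lam t) = suc (size t)
    size (ne h ts) = suc (sizeSp ts)

    sizeSp : ∀ {Γ : Ctx Sort} {τ a} → Sp 𝔖 Γ τ a → ℕ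
    sizeSp [] = zero
    sizeSp (t ∷ ts) = size t + sizeSp ts

  mutual
    size-ren : ∀ {Γ Δ : Ctx Sort} {τ} (ρ : Ren Γ Δ) (t : Nf 𝔖 Γ τ) → size (ren 𝔖 ρ t) ≡ size t
    size-ren ρ (lam t) = cong suc (size-ren (liftR ρ) t)
    size-ren ρ (ne h ts) = cong suc (sizeSp-ren ρ ts)

    sizeSp-ren : ∀ {Γ Δ : Ctx Sort} {τ a} (ρ : Ren Γ Δ) (ts : Sp 𝔖 Γ τ a) →
                 sizeSp (renSp 𝔖 ρ ts) ≡ sizeSp ts
    sizeSp-ren ρ [] = refl
    sizeSp-ren ρ (t ∷ ts) = cong₂ _+_ (size-ren ρ t) (sizeSp-ren ρ ts)

  size-∈S : ∀ {Γ : Ctx Sort} {σ τ a} {t : Nf 𝔖 Γ σ} {ts : Sp 𝔖 Γ τ a} → t ∈S ts → size t ≤ sizeSp ts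
  size-∈S {t = t} {ts = _ ∷ ts} here = m≤m+n (size t) (sizeSp ts)
  size-∈S {ts = t' ∷ ts} (there m) = ≤-trans (size-∈S m) (m≤n+m (sizeSp ts) (size t'))

  size-Occ : ∀ {Δ : Ctx Sort} {τ τ'} {s : Nf 𝔖 Δ τ} {Z} {t : Nf 𝔖 (Δ ⧺ Z) τ'} → Occ s Z t →
             size t ≤ size s
  size-Occ here = ≤-refl
  size-Occ (olam o) = ≤-trans (n≤1+n _) (size-Occ o)
  size-Occ (oarg o m) = ≤-trans (≤-trans (size-∈S m) (n≤1+n _)) (size-Occ o)

  liftsS : ∀ {Δ Δ' : Ctx Sort} (Z : Ctx Sort) → PSub 𝔖 Δ Δ' → PSub 𝔖 (Δ ⧺ Z) (Δ' ⧺ Z)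
  liftsS ε θ = θ
  liftsS (Z ▷ τ) θ = liftS 𝔖 (liftsS Z θ)

  liftsS-inl : ∀ {Δ Δ' : Ctx Sort} {σ} (Z : Ctx Sort) (θ : PSub 𝔖 Δ Δ') (w : Var Δ σ) →
               liftsS Z θ (inl Z w) ≡ ren⊎ (inl Z) (θ w)
  liftsS-inl ε θ w with θ w
  ... | inj₁ y = refl
  ... | inj₂ t = cong inj₂ (sym (ren-id (λ v → refl) t))
  liftsS-inl (Z ▷ τ) θ w =
    trans (liftS-vs (liftsS Z θ) (inl Z w))
      (trans (cong (ren⊎ vs) (liftsS-inl Z θ w)) (ren⊎-vs-inl (θ w)))
    where
      ren⊎-vs-inl : ∀ {σ} (q : Var _ σ ⊎ Nf 𝔖 _ σ) → ren⊎ vs (ren⊎ (inl Z) q) ≡ ren⊎ (inl (Z ▷ τ)) q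
      ren⊎-vs-inl (inj₁ y) = refl
      ren⊎-vs-inl (inj₂ t) = cong inj₂ (ren-∘ (λ v → refl) t)

  liftsS-inr : ∀ {Δ Δ' : Ctx Sort} {σ} (Z : Ctx Sort) (θ : PSub 𝔖 Δ Δ') (z : Var Z σ) →
               liftsS Z θ (inr Z z) ≡ inj₁ (inr Z z)
  liftsS-inr (Z ▷ τ) θ vz = refl
  liftsS-inr (Z ▷ τ) θ (vs z) = trans (liftS-vs (liftsS Z θ) (inr Z z))
      (cong (ren⊎ vs) (liftsS-inr Z θ z))

  ren-inl-sub : ∀ {Δ Δ' : Ctx Sort} {τ} (Z : Ctx Sort) (θ : PSub 𝔖 Δ Δ') (t : Nf 𝔖 Δ τ) →
                ren 𝔖 (inl Z) (sub 𝔖 t θ) ≡ sub 𝔖 (ren 𝔖 (inl Z) t) (liftsS Z θ)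
  ren-inl-sub Z θ t = trans (ren-sub (inl Z) θ t)
      (trans (sub-cong (λ w → sym (liftsS-inl Z θ w)) t) (sym (sub-ren (inl Z) (liftsS Z θ) t)))

  renPS-inl-sub : ∀ {Δ Δ' : Ctx Sort} {ρ τ} (Z : Ctx Sort) (θ : PSub 𝔖 Δ Δ') (ps : PSp 𝔖 Δ ρ τ) →
                  renPS 𝔖 (inl Z) (subPS ps θ) ≡ subPS (renPS 𝔖 (inl Z) ps) (liftsS Z θ)
  renPS-inl-sub Z θ [] = refl
  renPS-inl-sub Z θ (ps ∷ʳ t) = cong₂ _∷ʳ_ (renPS-inl-sub Z θ ps) (ren-inl-sub Z θ t)

  μ-inl : ∀ {Γ} (X Y : Ctx Sort) (ss : Tms 𝔖 (Γ ⧺ X) Y) → ∀ {σ} (γ : Var Γ σ) →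
          μ 𝔖 X Y ss (inl Y γ) ≡ inj₁ (inl X γ)
  μ-inl X ε ss γ = refl
  μ-inl X (Y ▷ τ) ss γ = μ-inl X Y (λ y → ss (vs y)) γ

  μ-inr : ∀ {Γ} (X Y : Ctx Sort) (ss : Tms 𝔖 (Γ ⧺ X) Y) → ∀ {σ} (m : Var Y σ) →
          μ 𝔖 X Y ss (inr {Δ = Γ} Y m) ≡ inj₂ (ss m)
  μ-inr X (Y ▷ τ) ss vz = refl
  μ-inr X (Y ▷ τ) ss (vs m) = μ-inr X Y (λ y → ss (vs y)) m

module Images (𝔖 : Signature) {Γ X Y : Ctx (Signature.Sort 𝔖)}
              (ss : Tms 𝔖 (Γ ⧺ X) Y) (hs : DHPVarArgList 𝔖 Γ X ss) where
  open Signature 𝔖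
  open Spines 𝔖

  θ : PSub 𝔖 (Γ ⧺ Y) (Γ ⧺ X)
  θ = μ 𝔖 X Y ss

  θZ : (Z : Ctx Sort) → PSub 𝔖 ((Γ ⧺ Y) ⧺ Z) ((Γ ⧺ X) ⧺ Z)
  θZ Z = liftsS Z θ

  ss-expanded : ∀ {σ} (m : Var Y σ) → Expanded 𝔖 (ss m)
  ss-expanded m = proj₁ (proj₂ (proj₂ (hs m)))

  ss-fv : ∀ {σ} (m : Var Y σ) → Σ (Ty Sort) λ σ' → Σ (Var (Γ ⧺ X) σ') λ v → v ∈F ss m
  ss-fv m = proj₁ (hs m)

  ss-no-Γ : ∀ {σ σ'} (m : Var Y σ) (v : Var Γ σ') → inl X v ∈F ss m → ⊥
  ss-no-Γ m v = proj₁ (proj₂ (hs m)) v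

  ss-no-SubE : ∀ {σ τ} (m : Var Y σ) (j : Var Y τ) → ¬ SameVar m j → SubE 𝔖 X (ss m) (ss j) → ⊥
  ss-no-SubE m j = proj₂ (proj₂ (proj₂ (hs m))) j

  θZ-Γ : ∀ {σ} (Z : Ctx Sort) (γ : Var Γ σ) → θZ Z (inl Z (inl Y γ)) ≡ inj₁ (inl Z (inl X γ))
  θZ-Γ Z γ = trans (liftsS-inl Z θ (inl Y γ)) (cong (ren⊎ (inl Z)) (μ-inl X Y ss γ))

  θZ-Y : ∀ {σ ρ} (Z : Ctx Sort) (m : Var Y σ) (g : Head 𝔖 (Γ ⧺ X) ρ) (b : PSp 𝔖 (Γ ⧺ X) ρ σ) →
         ss m ≡ expand 𝔖 σ g b →
         θZ Z (inl Z (inr Y m)) ≡ inj₂ (expand 𝔖 σ (renH 𝔖 (inl Z) g) (renPS 𝔖 (inl Z) b))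
  θZ-Y {σ} Z m g b e = trans (liftsS-inl Z θ (inr Y m))
      (trans (cong (ren⊎ (inl Z)) (μ-inr X Y ss m))
                         (cong inj₂ (trans (cong (ren 𝔖 (inl Z)) e) (ren-expand σ (inl Z) g b))))

  data Kept (Z : Ctx Sort) : ∀ {σ} → Head 𝔖 ((Γ ⧺ Y) ⧺ Z) σ → Head 𝔖 ((Γ ⧺ X) ⧺ Z) σ → Set where
    kept-fun : ∀ {σ} {f : Sym σ} → Kept Z (fun f) (fun f)
    kept-Γ : ∀ {σ} (γ : Var Γ σ) → Kept Z (var (inl Z (inl Y γ))) (var (inl Z (inl X γ)))
    kept-Z : ∀ {σ} (z : Var Z σ) → Kept Z (var (inr Z z)) (var (inr Z z))

  data HeadClass (Z : Ctx Sort) : ∀ {σ} → Head 𝔖 ((Γ ⧺ Y) ⧺ Z) σ → Set where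
    kept : ∀ {σ} {h : Head 𝔖 _ σ} {H} → Kept Z h H → HeadClass Z h
    replaced : ∀ {σ ρ} (m : Var Y σ) (g : Head 𝔖 (Γ ⧺ X) ρ) (b : PSp 𝔖 (Γ ⧺ X) ρ σ) →
               ss m ≡ expand 𝔖 σ g b → HeadClass Z (var (inl Z (inr Y m)))

  classifyHead : ∀ {σ} (Z : Ctx Sort) (h : Head 𝔖 ((Γ ⧺ Y) ⧺ Z) σ) → HeadClass Z h
  classifyHead Z (fun f) = kept kept-fun
  classifyHead Z (var v) with varView Z v
  ... | right z = kept (kept-Z z)
  ... | left w with varView {Δ = Γ} Y w
  ... | left γ = kept (kept-Γ γ)
  ... | right m with ss-expanded m
  ... | ρ , g , b , e = replaced m g b e

  kept-HeadImage : ∀ {σ} {Z : Ctx Sort} {h : Head 𝔖 _ σ} {H} → Kept Z h H → HeadImage (θZ Z) h H []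
  kept-HeadImage kept-fun = hi-fun
  kept-HeadImage {Z = Z} (kept-Γ γ) = hi-var (θZ-Γ Z γ)
  kept-HeadImage {Z = Z} (kept-Z z) = hi-var (liftsS-inr Z θ z)

  replaced-HeadImage : ∀ {σ ρ} (Z : Ctx Sort) (m : Var Y σ) (g : Head 𝔖 (Γ ⧺ X) ρ)
                       (b : PSp 𝔖 (Γ ⧺ X) ρ σ) →
                       (e : ss m ≡ expand 𝔖 σ g b) →
                       HeadImage (θZ Z) (var (inl Z (inr Y m))) (renH 𝔖 (inl Z) g)
                         (renPS 𝔖 (inl Z) b)
  replaced-HeadImage Z m g b e = hi-sub (θZ-Y Z m g b e)

  Kept-injective : ∀ {σ} {Z : Ctx Sort} {h h' : Head 𝔖 _ σ} {H H'} → Kept Z h H → Kept Z h' H' →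
                   H ≡ H' → h ≡ h'
  Kept-injective kept-fun kept-fun refl = refl
  Kept-injective kept-fun (kept-Γ γ) ()
  Kept-injective kept-fun (kept-Z z) ()
  Kept-injective (kept-Γ γ) kept-fun ()
  Kept-injective {Z = Z} (kept-Γ γ) (kept-Γ γ') e with inl-inj X (inl-inj Z (var-inj e))
  ... | refl = refl
  Kept-injective {Z = Z} (kept-Γ γ) (kept-Z z) e = ⊥-elim (inl≢inr Z (var-inj e))
  Kept-injective (kept-Z z) kept-fun ()
  Kept-injective {Z = Z} (kept-Z z) (kept-Γ γ) e = ⊥-elim (inl≢inr Z (sym (var-inj e)))
  Kept-injective {Z = Z} (kept-Z z) (kept-Z z') e with inr-inj Z (var-inj e)
  ... | refl = refl

  ss-head-var∈X : ∀ {σ ρ} (m : Var Y σ) (g : Head 𝔖 (Γ ⧺ X) ρ) (b : PSp 𝔖 (Γ ⧺ X) ρ σ) →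
                  ss m ≡ expand 𝔖 σ g b → ∀ (v : Var (Γ ⧺ X) ρ) → g ≡ var v → Σ (Var X ρ) λ x →
                  v ≡ inr X x
  ss-head-var∈X {σ} m g b e v eg with varView {Δ = Γ} X v
  ... | right x = x , refl
  ... | left γ = ⊥-elim
      (ss-no-Γ m γ (subst (_ ∈F_) (sym e)
      (subst (λ g' → _ ∈F expand 𝔖 σ g' b) (sym eg) (fv-expand-head σ _ b))))

  IsFun : ∀ {Δ : Ctx Sort} {ρ} → Head 𝔖 Δ ρ → Set
  IsFun {ρ = ρ} g = Σ (Sym ρ) λ f → g ≡ fun f

  Kept-ss-head-fun : ∀ {ρ} {Z : Ctx Sort} {h : Head 𝔖 _ ρ} {H} → Kept Z h H →
                     (g : Head 𝔖 (Γ ⧺ X) ρ) → H ≡ renH 𝔖 (inl Z) g →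
                     (∀ (v : Var (Γ ⧺ X) ρ) → g ≡ var v → Σ (Var X ρ) λ x → v ≡ inr X x) → IsFun g
  Kept-ss-head-fun n (fun f) e gx = f , refl
  Kept-ss-head-fun n (var v) e gx with gx v refl
  Kept-ss-head-fun kept-fun (var .(inr X x)) () gx | x , refl
  Kept-ss-head-fun {Z = Z} (kept-Γ γ) (var .(inr X x)) e gx | x , refl = ⊥-elim
      (inl≢inr X (inl-inj Z (var-inj e)))
  Kept-ss-head-fun {Z = Z} (kept-Z z) (var .(inr X x)) e gx | x , refl = ⊥-elim
      (inl≢inr Z (sym (var-inj e)))

  StartsWith : ∀ {Δ' : Ctx Sort} {σ ρ a} (κ : Ren (Γ ⧺ X) Δ') (g : Head 𝔖 (Γ ⧺ X) ρ)
               (b : PSp 𝔖 (Γ ⧺ X) ρ σ) →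
               Nf 𝔖 Δ' (ι a) → Set
  StartsWith {Δ'} {σ} {a = a} κ g b M = Σ (Sp 𝔖 Δ' σ a) λ r → M ≡ ne (renH 𝔖 κ g) (renPS 𝔖 κ b ++ r)

  StartsWith-ren : ∀ {Δ' Δ'' : Ctx Sort} {σ ρ a} {κ : Ren (Γ ⧺ X) Δ'} {g : Head 𝔖 (Γ ⧺ X) ρ}
                   {b : PSp 𝔖 (Γ ⧺ X) ρ σ} {M : Nf 𝔖 Δ' (ι a)} (ρ' : Ren Δ' Δ'')
                   (κ' : Ren (Γ ⧺ X) Δ'') →
                   (∀ {τ} (v : Var _ τ) → ρ' (κ v) ≡ κ' v) → StartsWith κ g b M →
                   StartsWith κ' g b (ren 𝔖 ρ' M)
  StartsWith-ren {κ = κ} {g = g} {b} ρ' κ' e (r , refl) =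
    renSp 𝔖 ρ' r , cong₂ ne (renH-∘ {ρ = ρ'} {ρ' = κ} e g)
        (trans (renSp-++ ρ' (renPS 𝔖 κ b) r)
        (cong (λ q → q ++ renSp 𝔖 ρ' r) (renPS-∘ {ρ = ρ'} {ρ' = κ} e b)))

  StartsWith-unren : ∀ {Δ0 Δ' : Ctx Sort} {σ ρ a} {κ : Ren Δ0 Δ'} → Injective κ →
                     {σ' : Ren (Γ ⧺ X) Δ'} {σ0 : Ren (Γ ⧺ X) Δ0} {g : Head 𝔖 (Γ ⧺ X) ρ}
                       {b : PSp 𝔖 (Γ ⧺ X) ρ σ} (M0 : Nf 𝔖 Δ0 (ι a)) →
                     (∀ {τ} (v : Var _ τ) → σ' v ≡ κ (σ0 v)) → StartsWith σ' g b (ren 𝔖 κ M0) →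
                     StartsWith σ0 g b M0
  StartsWith-unren {κ = κ} i {σ'} {σ0} {g} {b} (ne h0 ts0) ex (r , e) with ne-inj e
  ... | same-ne eh es with renSp-split i ts0 (renPS 𝔖 σ0 b)
      (trans es (cong (λ q → q ++ r) (sym (renPS-∘ (λ v → sym (ex v)) b))))
  ... | r0 , e1 , e2 =
    r0 , cong₂ ne (renH-inj i h0 (renH 𝔖 σ0 g) (trans eh (sym (renH-∘ (λ v → sym (ex v)) g)))) e1

  StartsWith-fv : ∀ {Δ' : Ctx Sort} {σ ρ a} (m : Var Y σ) {κ : Ren (Γ ⧺ X) Δ'}
                  {g : Head 𝔖 (Γ ⧺ X) ρ} {b : PSp 𝔖 (Γ ⧺ X) ρ σ} {M : Nf 𝔖 Δ' (ι a)} →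
                  ss m ≡ expand 𝔖 σ g b → StartsWith κ g b M → Σ (Ty Sort) λ τ →
                  Σ (Var (Γ ⧺ X) τ) λ v → κ v ∈F M
  StartsWith-fv {σ = σ} m {κ} {g} {b} e (r , refl) with ss-fv m
  ... | τ , v , p with fv-expand-inv σ g b (subst (_ ∈F_) e p)
  ... | inj₁ head-var = τ , v , head
  ... | inj₂ (_ , b0 , m0 , q) = τ , v , arg (∈PS→∈++ r (ren-∈PS κ m0)) (fv-ren κ q)

  Prefix⇒SubE : ∀ {σA σB ρ} (mA : Var Y σA) (mB : Var Y σB) (g : Head 𝔖 (Γ ⧺ X) ρ)
                (bA : PSp 𝔖 (Γ ⧺ X) ρ σA) (bB : PSp 𝔖 (Γ ⧺ X) ρ σB) →
                ss mA ≡ expand 𝔖 σA g bA → ss mB ≡ expand 𝔖 σB g bB → Prefix bB bA →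
                SubE 𝔖 X (ss mA) (ss mB)
  Prefix⇒SubE {σA} mA mB g bA bB eA eB pre with expand-body σA g bA
  ... | W , a , B , oB , rB , eB' with Prefix-++ {b1 = bB} {b2 = bA} pre (inl W) rB
  ... | r' , e' =
    _ , g , bB , eB , W , a , r' ,
    subst (λ w → _⊵_ 𝔖 (lams 𝔖 X w) _) (sym eA)
        (Occ⇒⊵ X (subst (Occ _ W) (trans eB' (cong (ne _) e')) oB))

  -- For j = m the head of s_j would occur strictly inside its own argument, which is too small;
  -- otherwise the occurrence shows s_j ⊵_E s_m.
  no-image-in-argument : ∀ {σj σm ρj ρm τb} (j : Var Y σj) (gj : Head 𝔖 (Γ ⧺ X) ρj)
                         (bj : PSp 𝔖 (Γ ⧺ X) ρj σj) →
                         ss j ≡ expand 𝔖 σj gj bj → {b : Nf 𝔖 (Γ ⧺ X) τb} → b ∈PS bj →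
                         (Z' : Ctx Sort) {a : Sort} {M0 : Nf 𝔖 ((Γ ⧺ X) ⧺ Z') (ι a)} → Occ b Z' M0 →
                         (m : Var Y σm) (gm : Head 𝔖 (Γ ⧺ X) ρm) (bm : PSp 𝔖 (Γ ⧺ X) ρm σm) →
                         ss m ≡ expand 𝔖 σm gm bm → StartsWith (inl Z') gm bm M0 → ⊥
  no-image-in-argument {σj} j gj bj ej {b} mb Z' {M0 = M0} o m gm bm em im with eqv j m
  no-image-in-argument {σj} j gj bj ej {b} mb Z' o .j gm bm em (r , refl) | same
    with expand-inj σj gj bj gm bm (trans (sym ej) em)
  ... | refl , refl , refl = <-irrefl refl (begin-strict
    size (ren 𝔖 (inl Z') b)
      <⟨ s≤s (size-∈S (∈PS→∈++ r (ren-∈PS (inl Z') mb))) ⟩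
    size (ne (renH 𝔖 (inl Z') gj) (renPS 𝔖 (inl Z') bj ++ r))
      ≤⟨ size-Occ o ⟩
    size b
      ≡⟨ sym (size-ren (inl Z') b) ⟩
    size (ren 𝔖 (inl Z') b) ∎)
    where open ≤-Reasoning
  no-image-in-argument {σj} j gj bj ej {b} mb Z' {a} {M0} o .(wkv j m') gm bm em im | diff .j m' =
      ss-no-SubE j (wkv j m') (¬SameVar-wkv j m') sube
    where
      sube : SubE 𝔖 X (ss j) (ss (wkv j m'))
      sube with expand-body σj gj bj
      ... | W , a' , B , oB , rB , eB =
        let o1 = oarg (subst (Occ _ W) eB oB) (∈PS→∈++ rB (ren-∈PS (inl W) mb))
            o3 = Occ-trans o1 (Occ-ren (inl W) o)
            im1 = StartsWith-ren {g = gm} {b = bm} (liftsR Z' (inl W)) (λ v → inl Z' (inl W v))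
                (λ v → liftsR-inl Z' (inl W) v) im
            im3 = StartsWith-ren {g = gm} {b = bm} (assocR W Z') (inl (W ⧺ Z'))
                (λ v → assocR-inl W Z' v) im1
        in _ , gm , bm , em , (W ⧺ Z') , a , proj₁ im3 ,
           subst (λ w → _⊵_ 𝔖 (lams 𝔖 X w) _) (sym ej)
               (Occ⇒⊵ X (subst (Occ _ (W ⧺ Z')) (proj₂ im3) o3))

  headImage : ∀ {σ} (Z : Ctx Sort) (h : Head 𝔖 ((Γ ⧺ Y) ⧺ Z) σ) → Σ (Ty Sort) λ ρ →
              Σ (Head 𝔖 ((Γ ⧺ X) ⧺ Z) ρ) λ H → Σ (PSp 𝔖 ((Γ ⧺ X) ⧺ Z) ρ σ) λ P →
              HeadImage (θZ Z) h H P
  headImage Z h with classifyHead Z h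
  ... | kept n = _ , _ , [] , kept-HeadImage n
  ... | replaced m g b e = _ , _ , _ , replaced-HeadImage Z m g b e

  Expansion : ∀ {σ} → Var Y σ → Set
  Expansion {σ} m = Σ (Ty Sort) λ ρ → Σ (Head 𝔖 (Γ ⧺ X) ρ) λ g → Σ (PSp 𝔖 (Γ ⧺ X) ρ σ) λ b →
      ss m ≡ expand 𝔖 σ g b

  image-at-Y : ∀ {σ τ} (Z : Ctx Sort) (m : Var Y σ) (t : Nf 𝔖 ((Γ ⧺ Y) ⧺ Z) τ) →
               inl Z (inr Y m) ∈F t → Σ (Ctx Sort) λ Z' → Σ Sort λ a →
               Σ (Nf 𝔖 (((Γ ⧺ X) ⧺ Z) ⧺ Z') (ι a)) λ M →
               Occ (sub 𝔖 t (θZ Z)) Z' M × Σ (Expansion m) λ d →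
               StartsWith (λ v → inl Z' (inl Z v)) (proj₁ (proj₂ d)) (proj₁ (proj₂ (proj₂ d))) M
  image-at-Y Z m (lam {σ = σ'} t) (lam p) with image-at-Y (Z ▷ σ') m t p
  ... | Z' , a , M , o , (ρ , g , b , e) , im =
    prepend σ' Z' , a , ren 𝔖 (shiftR Z') M , Occ-shift o , (ρ , g , b , e) ,
    StartsWith-ren {g = g} {b = b} (shiftR Z') (λ v → inl (prepend σ' Z') (inl Z v))
        (λ v → shiftR-inl Z' (inl Z v)) im
  image-at-Y Z m (ne .(var (inl Z (inr Y m))) ts) head with ss-expanded m
  ... | ρ , g , b , e =
    ε , _ , _ , here , (ρ , g , b , e) ,
    subSp 𝔖 ts (θZ Z) , sub-ne (replaced-HeadImage Z m g b e) ts
  image-at-Y Z m (ne h ts) (arg {s = s} mem p) with image-at-Y Z m s p | headImage Z h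
  ... | Z' , a , M , o , d , im | _ , H , P , hi =
    Z' , a , M , Occ-trans-ε s-below-h o , d , im
    where
      s-below-h : Occ (sub 𝔖 (ne h ts) (θZ Z)) ε (sub 𝔖 s (θZ Z))
      s-below-h = subst (λ w → Occ w ε (sub 𝔖 s (θZ Z))) (sym (sub-ne hi ts))
                    (oarg here (∈++-right P (sub-∈S (θZ Z) mem)))

  FvOrigin : ∀ {σ' τ} (Z : Ctx Sort) → Var ((Γ ⧺ X) ⧺ Z) σ' → Nf 𝔖 ((Γ ⧺ Y) ⧺ Z) τ → Set
  FvOrigin {σ'} Z x t =
    (Σ (Var Γ σ') λ γ → inl Z (inl Y γ) ∈F t × x ≡ inl Z (inl X γ)) ⊎
    ((Σ (Var Z σ') λ z → inr Z z ∈F t × x ≡ inr Z z) ⊎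
     (Σ (Ty Sort) λ σm → Σ (Var Y σm) λ m → inl Z (inr Y m) ∈F t × Σ (Var (Γ ⧺ X) σ') λ v →
         x ≡ inl Z v × v ∈F ss m))

  FvOrigin-map : ∀ {σ' τ τ'} {Z : Ctx Sort} {x : Var ((Γ ⧺ X) ⧺ Z) σ'} {c : Nf 𝔖 _ τ}
                 {t : Nf 𝔖 _ τ'} →
                 (∀ {σ''} {w : Var _ σ''} → w ∈F c → w ∈F t) → FvOrigin Z x c → FvOrigin Z x t
  FvOrigin-map f (inj₁ (γ , q , e)) = inj₁ (γ , f q , e)
  FvOrigin-map f (inj₂ (inj₁ (z , q , e))) = inj₂ (inj₁ (z , f q , e))
  FvOrigin-map f (inj₂ (inj₂ (σm , m , q , r))) = inj₂ (inj₂ (σm , m , f q , r))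

  fv-ne-++ : ∀ {Δ : Ctx Sort} {σ' ρ τ a} {x : Var Δ σ'} {H : Head 𝔖 Δ ρ} {P : PSp 𝔖 Δ ρ τ}
             {R : Sp 𝔖 Δ τ a} →
             x ∈F ne H (P ++ R) →
             HeadVar H x ⊎
               ((Σ (Ty Sort) λ τ' → Σ (Nf 𝔖 Δ τ') λ s → s ∈PS P × x ∈F s) ⊎
               (Σ (Ty Sort) λ τ' → Σ (Nf 𝔖 Δ τ') λ s → s ∈S R × x ∈F s))
  fv-ne-++ head = inj₁ head-var
  fv-ne-++ {P = P} (arg mm q) with ∈++-split P mm
  ... | inj₁ m1 = inj₂ (inj₁ (_ , _ , m1 , q))
  ... | inj₂ m2 = inj₂ (inj₂ (_ , _ , m2 , q))

  HeadVar-ren : ∀ {Δ Δ' : Ctx Sort} {σ ρ} (κ : Ren Δ Δ') (g : Head 𝔖 Δ ρ) {x : Var Δ' σ} →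
                HeadVar (renH 𝔖 κ g) x → Σ (Var Δ σ) λ v → HeadVar g v × κ v ≡ x
  HeadVar-ren κ (var w) head-var = w , head-var , refl

  HeadVar-fv : ∀ {Δ : Ctx Sort} {σ ρ} (τ : Ty Sort) {g : Head 𝔖 Δ ρ} {v : Var Δ σ}
               (ps : PSp 𝔖 Δ ρ τ) →
               HeadVar g v → v ∈F expand 𝔖 τ g ps
  HeadVar-fv τ ps head-var = fv-expand-head τ _ ps

  mutual
    fv-sub : ∀ {σ' τ} (Z : Ctx Sort) (t : Nf 𝔖 ((Γ ⧺ Y) ⧺ Z) τ) {x : Var ((Γ ⧺ X) ⧺ Z) σ'} →
             x ∈F sub 𝔖 t (θZ Z) → FvOrigin Z x t
    fv-sub Z (lam {σ = σ} t) (lam p) with fv-sub (Z ▷ σ) t p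
    ... | inj₁ (γ , q , e) = inj₁ (γ , lam q , vs-inj e)
    ... | inj₂ (inj₁ (vz , q , ()))
    ... | inj₂ (inj₁ (vs z , q , e)) = inj₂ (inj₁ (z , lam q , vs-inj e))
    ... | inj₂ (inj₂ (σm , m , q , v , e , fq)) = inj₂ (inj₂ (σm , m , lam q , v , vs-inj e , fq))
    fv-sub Z (ne h ts) p = fv-sub-ne Z h ts (classifyHead Z h) p

    fv-sub-ne : ∀ {σ' σ a} (Z : Ctx Sort) (h : Head 𝔖 ((Γ ⧺ Y) ⧺ Z) σ) (ts : Sp 𝔖 _ σ a) →
                HeadClass Z h → {x : Var ((Γ ⧺ X) ⧺ Z) σ'} → x ∈F sub 𝔖 (ne h ts) (θZ Z) →
                FvOrigin Z x (ne h ts)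
    fv-sub-ne Z h ts (kept n) p with fv-ne-++ {P = []}
        (subst (_ ∈F_) (sub-ne (kept-HeadImage n) ts) p)
    fv-sub-ne Z h ts (kept kept-fun) p | inj₁ ()
    fv-sub-ne Z h ts (kept (kept-Γ γ)) p | inj₁ head-var = inj₁ (γ , head , refl)
    fv-sub-ne Z h ts (kept (kept-Z z)) p | inj₁ head-var = inj₂ (inj₁ (z , head , refl))
    fv-sub-ne Z h ts (kept n) p | inj₂ (inj₁ (_ , _ , () , _))
    fv-sub-ne Z h ts (kept n) p | inj₂ (inj₂ (_ , s , ms , q)) = fv-sub-args Z h ts ms q
    fv-sub-ne Z h ts (replaced {σ = σm} m g b e) p with fv-ne-++
        (subst (_ ∈F_) (sub-ne (replaced-HeadImage Z m g b e) ts) p)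
    ... | inj₁ hv with HeadVar-ren (inl Z) g hv
    ... | v , hv' , refl =
      inj₂ (inj₂ (σm , m , head , v , refl , subst (_ ∈F_) (sym e) (HeadVar-fv σm b hv')))
    fv-sub-ne Z h ts (replaced {σ = σm} m g b e) p | inj₂ (inj₁ (_ , s , ms , q))
      with ∈PS-ren-inv (inl Z) b ms
    ... | b0 , mb0 , refl with fv-ren-inv (inl Z) b0 q
    ... | v , refl , q' =
      inj₂ (inj₂ (σm , m , head , v , refl , subst (_ ∈F_) (sym e) (fv-expand-arg σm g mb0 q')))
    fv-sub-ne Z h ts (replaced m g b e) p | inj₂ (inj₂ (_ , s , ms , q)) = fv-sub-args Z h ts ms q

    fv-sub-args : ∀ {σ' σ τs a} (Z : Ctx Sort) (h : Head 𝔖 ((Γ ⧺ Y) ⧺ Z) σ) (ts : Sp 𝔖 _ σ a)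
                  {s : Nf 𝔖 _ τs} {x : Var ((Γ ⧺ X) ⧺ Z) σ'} →
                  s ∈S subSp 𝔖 ts (θZ Z) → x ∈F s → FvOrigin Z x (ne h ts)
    fv-sub-args Z h ts ms q = fv-sub-args′ Z h ts ts (λ m → m) ms q

    fv-sub-args′ : ∀ {σ' σ σ1 τs a} (Z : Ctx Sort) (h : Head 𝔖 ((Γ ⧺ Y) ⧺ Z) σ) (ts : Sp 𝔖 _ σ a)
                   (us : Sp 𝔖 _ σ1 a) (inc : ∀ {τ'} {c : Nf 𝔖 _ τ'} → c ∈S us → c ∈S ts)
                   {s : Nf 𝔖 _ τs} {x : Var ((Γ ⧺ X) ⧺ Z) σ'} →
                   s ∈S subSp 𝔖 us (θZ Z) → x ∈F s → FvOrigin Z x (ne h ts)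
    fv-sub-args′ Z h ts (u ∷ us) inc here q = FvOrigin-map (arg (inc here)) (fv-sub Z u q)
    fv-sub-args′ Z h ts (u ∷ us) inc (there ms) q = fv-sub-args′ Z h ts us
        (λ m → inc (there m)) ms q

  no-image-in-renamed-argument : ∀ {σj ρj τb} (j : Var Y σj) (gj : Head 𝔖 (Γ ⧺ X) ρj)
      (bj : PSp 𝔖 (Γ ⧺ X) ρj σj) →
      ss j ≡ expand 𝔖 σj gj bj → {b : Nf 𝔖 (Γ ⧺ X) τb} → b ∈PS bj →
      (Z2 : Ctx Sort) {τN : Ty Sort} {N0 : Nf 𝔖 ((Γ ⧺ X) ⧺ Z2) τN} → Occ b Z2 N0 →
      {Δ' : Ctx Sort} (κ : Ren ((Γ ⧺ X) ⧺ Z2) Δ') → Injective κ → (ι' : Ren (Γ ⧺ X) Δ') →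
      (∀ {τ} (v : Var (Γ ⧺ X) τ) → κ (inl Z2 v) ≡ ι' v) →
      (Z3 : Ctx Sort) {a : Sort} {M : Nf 𝔖 (Δ' ⧺ Z3) (ι a)} → Occ (ren 𝔖 κ N0) Z3 M →
      ∀ {σm ρm} (m : Var Y σm) (gm : Head 𝔖 (Γ ⧺ X) ρm) (bm : PSp 𝔖 (Γ ⧺ X) ρm σm) →
      ss m ≡ expand 𝔖 σm gm bm → StartsWith (λ v → inl Z3 (ι' v)) gm bm M → ⊥
  no-image-in-renamed-argument j gj bj ej mb Z2 {N0 = N0} o2 κ i ι' eκ Z3 o3 m gm bm em im
    with Occ-ren-inv κ N0 o3
  ... | M0 , o0 , refl =
    let im0 = StartsWith-unren {κ = liftsR Z3 κ} (liftsR-inj Z3 i) {σ0 = λ v → inl Z3 (inl Z2 v)}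
                {g = gm} {b = bm} M0
                (λ v → sym (trans (liftsR-inl Z3 κ (inl Z2 v)) (cong (inl Z3) (eκ v)))) im
        im1 = StartsWith-ren {g = gm} {b = bm} (assocR Z2 Z3) (inl (Z2 ⧺ Z3))
                (λ v → assocR-inl Z2 Z3 v) im0
    in no-image-in-argument j gj bj ej mb (Z2 ⧺ Z3) (Occ-trans o2 o0) m gm bm em im1

  -- A free variable of b comes from Γ (excluded by (i) for s_j), or from an image of some s_m
  -- inside b, which no-image-in-renamed-argument rules out.
  image-argument-closed : ∀ {σj ρj τb σv} (Z : Ctx Sort) (c : Nf 𝔖 ((Γ ⧺ Y) ⧺ Z) τb) (j : Var Y σj)
                          (gj : Head 𝔖 (Γ ⧺ X) ρj) (bj : PSp 𝔖 (Γ ⧺ X) ρj σj) →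
                          ss j ≡ expand 𝔖 σj gj bj → {b : Nf 𝔖 (Γ ⧺ X) τb} → b ∈PS bj →
                          ren 𝔖 (inl Z) b ≡ sub 𝔖 c (θZ Z) → (v : Var (Γ ⧺ X) σv) → v ∈F b → ⊥
  image-argument-closed {σj = σj} Z c j gj bj ej {b} mb eb v p
    with fv-sub Z c (subst (_ ∈F_) eb (fv-ren (inl Z) p))
  ... | inj₁ (γ , _ , e) with inl-inj Z e
  ... | refl = ss-no-Γ j γ (subst (_ ∈F_) (sym ej) (fv-expand-arg σj gj mb p))
  image-argument-closed Z c j gj bj ej {b} mb eb v p | inj₂ (inj₁ (z , _ , e)) = inl≢inr Z e
  image-argument-closed Z c j gj bj ej {b} mb eb v p | inj₂ (inj₂ (σm , m , q , _))
    with image-at-Y Z m c q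
  ... | Z' , a , M , o , (ρm , gm , bm , em) , im =
    no-image-in-renamed-argument j gj bj ej mb ε here (inl Z) (inl-inj Z) (inl Z) (λ w → refl) Z'
        (subst (λ w → Occ w Z' M) (sym eb) o) m gm bm em im

  ss-fun-head-open-arg : ∀ {σj ρj} (j : Var Y σj) (gj : Head 𝔖 (Γ ⧺ X) ρj)
                         (bj : PSp 𝔖 (Γ ⧺ X) ρj σj) →
                         ss j ≡ expand 𝔖 σj gj bj → IsFun gj →
                         (∀ {τb} {b : Nf 𝔖 (Γ ⧺ X) τb} → b ∈PS bj → ∀ {σv} (v : Var (Γ ⧺ X) σv) →
                           v ∈F b → ⊥) →
                         ⊥
  ss-fun-head-open-arg {σj} j gj bj ej (f , refl) cl with ss-fv j
  ... | σ' , v , p with fv-expand-inv σj (fun f) bj (subst (_ ∈F_) ej p)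
  ... | inj₂ (_ , b , mb , q) = cl mb v q

  -- The head g of s_m would be a function symbol and its arguments b closed, so fv(s_m) = ∅.
  kept≢replaced : ∀ {σ ρ' a} {Z : Ctx Sort} {h : Head 𝔖 _ ρ'} {H : Head 𝔖 _ ρ'} → Kept Z h H →
                  (m : Var Y σ) (g : Head 𝔖 (Γ ⧺ X) ρ') (b : PSp 𝔖 (Γ ⧺ X) ρ' σ) →
                  ss m ≡ expand 𝔖 σ g b → H ≡ renH 𝔖 (inl Z) g →
                  (ts : Sp 𝔖 ((Γ ⧺ Y) ⧺ Z) ρ' a) {R : Sp 𝔖 _ σ a} →
                  subSp 𝔖 ts (θZ Z) ≡ renPS 𝔖 (inl Z) b ++ R → ⊥
  kept≢replaced {Z = Z} n m g b e eH ts es with subSp-split (θZ Z) ts (renPS 𝔖 (inl Z) b) es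
  ... | pre , post , _ , epre , _ =
    ss-fun-head-open-arg m g b e (Kept-ss-head-fun n g eH (ss-head-var∈X m g b e))
      (λ mb v q → let r = ∈PS-sub-inv (θZ Z) pre (subst (_ ∈PS_) (sym epre) (ren-∈PS (inl Z) mb))
                  in image-argument-closed Z (proj₁ r) m g b e mb (proj₂ (proj₂ r)) v q)

  -- One argument list is a prefix of the other, which gives s_m₁ ⊵_E s_m₂ or s_m₂ ⊵_E s_m₁.
  distinct-replaced : ∀ {σ1 σ2 ρ a} (Z : Ctx Sort) (m1 : Var Y σ1) (m2 : Var Y σ2) →
                      ¬ SameVar m1 m2 →
                      (g1 g2 : Head 𝔖 (Γ ⧺ X) ρ) (b1 : PSp 𝔖 (Γ ⧺ X) ρ σ1)
                        (b2 : PSp 𝔖 (Γ ⧺ X) ρ σ2) →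
                      ss m1 ≡ expand 𝔖 σ1 g1 b1 → ss m2 ≡ expand 𝔖 σ2 g2 b2 →
                      renH 𝔖 (inl Z) g1 ≡ renH 𝔖 (inl Z) g2 →
                      {R1 : Sp 𝔖 ((Γ ⧺ X) ⧺ Z) σ1 a} {R2 : Sp 𝔖 ((Γ ⧺ X) ⧺ Z) σ2 a} →
                      renPS 𝔖 (inl Z) b1 ++ R1 ≡ renPS 𝔖 (inl Z) b2 ++ R2 → ⊥
  distinct-replaced Z m1 m2 ns g1 g2 b1 b2 e1 e2 eg es with renH-inj (inl-inj Z) g1 g2 eg
  ... | refl with Prefix-comparable (inl-inj Z) b1 b2 es
  ... | inj₁ p12 = ss-no-SubE m2 m1 (λ s → ns (SameVar-sym s))
      (Prefix⇒SubE m2 m1 g1 b2 b1 e2 e1 p12)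
  ... | inj₂ p21 = ss-no-SubE m1 m2 ns (Prefix⇒SubE m1 m2 g1 b1 b2 e1 e2 p21)

  mutual
    sub-injective : ∀ {τ} (Z : Ctx Sort) (t1 t2 : Nf 𝔖 ((Γ ⧺ Y) ⧺ Z) τ) →
                    sub 𝔖 t1 (θZ Z) ≡ sub 𝔖 t2 (θZ Z) → t1 ≡ t2
    sub-injective Z (lam {σ = σ} t1) (lam t2) e = cong lam (sub-injective (Z ▷ σ) t1 t2 (lam-inj e))
    sub-injective Z (ne h1 ts1) (ne h2 ts2) e = sub-injective-ne Z h1 ts1 h2 ts2 (classifyHead Z h1)
        (classifyHead Z h2) e

    sub-injective-ne : ∀ {σ1 σ2 a} (Z : Ctx Sort) (h1 : Head 𝔖 ((Γ ⧺ Y) ⧺ Z) σ1) (ts1 : Sp 𝔖 _ σ1 a)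
                       (h2 : Head 𝔖 ((Γ ⧺ Y) ⧺ Z) σ2) (ts2 : Sp 𝔖 _ σ2 a) →
                       HeadClass Z h1 → HeadClass Z h2 →
                       sub 𝔖 (ne h1 ts1) (θZ Z) ≡ sub 𝔖 (ne h2 ts2) (θZ Z) → ne h1 ts1 ≡ ne h2 ts2
    sub-injective-ne Z h1 ts1 h2 ts2 (kept n1) (kept n2) e
      with sub-ne-inj (kept-HeadImage n1) (kept-HeadImage n2) ts1 ts2 e
    ... | same-ne eh es with Kept-injective n1 n2 eh
    ... | refl = cong (ne h1) (subSp-injective Z ts1 ts2 es)
    sub-injective-ne Z h1 ts1 h2 ts2 (kept n1) (replaced m g b em) e
      with sub-ne-inj (kept-HeadImage n1) (replaced-HeadImage Z m g b em) ts1 ts2 e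
    ... | same-ne eh es = ⊥-elim (kept≢replaced n1 m g b em eh ts1 es)
    sub-injective-ne Z h1 ts1 h2 ts2 (replaced m g b em) (kept n2) e
      with sub-ne-inj (kept-HeadImage n2) (replaced-HeadImage Z m g b em) ts2 ts1 (sym e)
    ... | same-ne eh es = ⊥-elim (kept≢replaced n2 m g b em eh ts2 es)
    sub-injective-ne Z h1 ts1 h2 ts2 (replaced m1 g1 b1 e1) (replaced m2 g2 b2 e2) e with eqv m1 m2
    sub-injective-ne {σ1} Z h1 ts1 h2 ts2 (replaced m1 g1 b1 e1) (replaced .m1 g2 b2 e2) e | same
      with expand-inj σ1 g1 b1 g2 b2 (trans (sym e1) e2)
    ... | refl , refl , refl
      with sub-ne-inj (replaced-HeadImage Z m1 g1 b1 e1)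
          (replaced-HeadImage Z m1 g1 b1 e1) ts1 ts2 e
    ... | same-ne _ es = cong (ne h1)
        (subSp-injective Z ts1 ts2 (++-cancelˡ (renPS 𝔖 (inl Z) b1) es))
    sub-injective-ne Z h1 ts1 h2 ts2 (replaced m1 g1 b1 e1)
        (replaced .(wkv m1 m') g2 b2 e2) e | diff .m1 m'
      with sub-ne-inj (replaced-HeadImage Z m1 g1 b1 e1)
          (replaced-HeadImage Z (wkv m1 m') g2 b2 e2) ts1 ts2 e
    ... | same-ne eh es = ⊥-elim
        (distinct-replaced Z m1 (wkv m1 m') (¬SameVar-wkv m1 m') g1 g2 b1 b2 e1 e2 eh es)

    subSp-injective : ∀ {σ a} (Z : Ctx Sort) (ts1 ts2 : Sp 𝔖 ((Γ ⧺ Y) ⧺ Z) σ a) →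
                      subSp 𝔖 ts1 (θZ Z) ≡ subSp 𝔖 ts2 (θZ Z) → ts1 ≡ ts2
    subSp-injective Z [] [] e = refl
    subSp-injective Z (t1 ∷ ts1) (t2 ∷ ts2) e = cong₂ _∷_ (sub-injective Z t1 t2 (proj₁ (∷-inj e)))
        (subSp-injective Z ts1 ts2 (proj₂ (∷-inj e)))

  subPS-injective : ∀ {ρ τ} (Z : Ctx Sort) (p1 p2 : PSp 𝔖 ((Γ ⧺ Y) ⧺ Z) ρ τ) →
                    subPS p1 (θZ Z) ≡ subPS p2 (θZ Z) → p1 ≡ p2
  subPS-injective Z [] [] e = refl
  subPS-injective Z [] (p2 ∷ʳ x) ()
  subPS-injective Z (p1 ∷ʳ x) [] ()
  subPS-injective Z (p1 ∷ʳ x1) (p2 ∷ʳ x2) e with ∷ʳ-inj e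
  ... | same-snoc e1 e2 = cong₂ _∷ʳ_ (subPS-injective Z p1 p2 e1) (sub-injective Z x1 x2 e2)

module Composition (𝔖 : Signature) {Γ X Y U : Ctx (Signature.Sort 𝔖)}
                   (us : Tms 𝔖 (Γ ⧺ Y) U) (ss : Tms 𝔖 (Γ ⧺ X) Y)
                   (hu : DHPVarArgList 𝔖 Γ Y us) (hs : DHPVarArgList 𝔖 Γ X ss) where
  open Signature 𝔖
  open Spines 𝔖
  open Images 𝔖 {Γ} {X} {Y} ss hs

  us-expanded : ∀ {σ} (i : Var U σ) → Expanded 𝔖 (us i)
  us-expanded i = proj₁ (proj₂ (proj₂ (hu i)))

  us-fv : ∀ {σ} (i : Var U σ) → Σ (Ty Sort) λ σ' → Σ (Var (Γ ⧺ Y) σ') λ v → v ∈F us i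
  us-fv i = proj₁ (hu i)

  us-no-Γ : ∀ {σ σ'} (i : Var U σ) (v : Var Γ σ') → inl Y v ∈F us i → ⊥
  us-no-Γ i v = proj₁ (proj₂ (hu i)) v

  us-no-SubE : ∀ {σ τ} (i : Var U σ) (j : Var U τ) → ¬ SameVar i j → SubE 𝔖 Y (us i) (us j) → ⊥
  us-no-SubE i j = proj₂ (proj₂ (proj₂ (hu i))) j

  data TopHead {σ} : Head 𝔖 (Γ ⧺ Y) σ → Set where
    top-fun : (f : Sym σ) → TopHead (fun f)
    top-Y : ∀ {ρ} (l : Var Y σ) (g : Head 𝔖 (Γ ⧺ X) ρ) (b : PSp 𝔖 (Γ ⧺ X) ρ σ) →
            ss l ≡ expand 𝔖 σ g b → TopHead (var (inr Y l))

  topHead : ∀ {σ ρ} (i : Var U σ) (h : Head 𝔖 (Γ ⧺ Y) ρ) (a : PSp 𝔖 (Γ ⧺ Y) ρ σ) →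
            us i ≡ expand 𝔖 σ h a → TopHead h
  topHead {σ} i h a e with classifyHead ε h
  ... | kept (kept-fun {f = f}) = top-fun f
  ... | kept (kept-Γ γ) = ⊥-elim (us-no-Γ i γ (subst (_ ∈F_) (sym e) (fv-expand-head σ _ a)))
  ... | kept (kept-Z ())
  ... | replaced l g b el = top-Y l g b el

  top-Y-image : ∀ {σ ρ} (l : Var Y σ) {g : Head 𝔖 (Γ ⧺ X) ρ} {b : PSp 𝔖 (Γ ⧺ X) ρ σ} →
                ss l ≡ expand 𝔖 σ g b → HeadImage θ (var (inr Y l)) g b
  top-Y-image l el = hi-sub (trans (μ-inr X Y ss l) (cong inj₂ el))

  sub-us : ∀ {σ ρ} (i : Var U σ) (h : Head 𝔖 (Γ ⧺ Y) ρ) (a : PSp 𝔖 (Γ ⧺ Y) ρ σ) →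
           us i ≡ expand 𝔖 σ h a → ∀ {ρ'} {H : Head 𝔖 (Γ ⧺ X) ρ'} {P} → HeadImage θ h H P →
           sub 𝔖 (us i) θ ≡ expand 𝔖 σ H (P ++ᴾ subPS a θ)
  sub-us {σ} i h a e hi = trans (cong (λ w → sub 𝔖 w θ) e) (sub-expand σ hi a)

  fun-headed-Y-arg : ∀ {σ ρ} (i : Var U σ) (f : Sym ρ) (a : PSp 𝔖 (Γ ⧺ Y) ρ σ) →
                     us i ≡ expand 𝔖 σ (fun f) a → Σ (Ty Sort) λ τa → Σ (Nf 𝔖 (Γ ⧺ Y) τa) λ a0 →
                     a0 ∈PS a × Σ (Ty Sort) λ σl → Σ (Var Y σl) λ l → inr Y l ∈F a0
  fun-headed-Y-arg {σ} i f a e with us-fv i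
  ... | σ' , v , p with fv-expand-inv σ (fun f) a (subst (_ ∈F_) e p)
  ... | inj₁ ()
  ... | inj₂ (τa , a0 , ma , q) with varView {Δ = Γ} Y v
  ... | left γ = ⊥-elim (us-no-Γ i γ p)
  ... | right l = τa , a0 , ma , σ' , l , q

  -- N lies inside an argument of some s_j inserted by θ.
  data InsideArg (Z : Ctx Sort) {τN} (N : Nf 𝔖 ((Γ ⧺ X) ⧺ Z) τN) : Set where
    inside-arg : ∀ {σj ρj τb} (j : Var Y σj) (gj : Head 𝔖 (Γ ⧺ X) ρj) (bj : PSp 𝔖 (Γ ⧺ X) ρj σj) →
                 ss j ≡ expand 𝔖 σj gj bj → {b : Nf 𝔖 (Γ ⧺ X) τb} → b ∈PS bj →
                 (Z2 : Ctx Sort) {N0 : Nf 𝔖 ((Γ ⧺ X) ⧺ Z2) τN} → Occ b Z2 N0 →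
                 (κ : Ren ((Γ ⧺ X) ⧺ Z2) ((Γ ⧺ X) ⧺ Z)) → Injective κ →
                 (∀ {τ} (v : Var (Γ ⧺ X) τ) → κ (inl Z2 v) ≡ inl Z v) → N ≡ ren 𝔖 κ N0 →
                 InsideArg Z N

  Origin : ∀ {τ τN} (u : Nf 𝔖 (Γ ⧺ Y) τ) (Z : Ctx Sort) (N : Nf 𝔖 ((Γ ⧺ X) ⧺ Z) τN) → Set
  Origin {τN = τN} u Z N =
      (Σ (Nf 𝔖 ((Γ ⧺ Y) ⧺ Z) τN) λ t' → Occ u Z t' × N ≡ sub 𝔖 t' (θZ Z)) ⊎ InsideArg Z N

  origin-ne : ∀ {τ σ' a τN} (u : Nf 𝔖 (Γ ⧺ Y) τ) (Z : Ctx Sort) {h : Head 𝔖 ((Γ ⧺ X) ⧺ Z) σ'}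
              {ts : Sp 𝔖 _ σ' a} {N : Nf 𝔖 _ τN} →
              N ∈S ts → ∀ {σ''} (h' : Head 𝔖 ((Γ ⧺ Y) ⧺ Z) σ'') (ts' : Sp 𝔖 _ σ'' a) →
              Occ u Z (ne h' ts') → ne h ts ≡ sub 𝔖 (ne h' ts') (θZ Z) → HeadClass Z h' →
              Origin u Z N
  origin-ne u Z mem h' ts' o e (kept n) with ne-inj (trans e (sub-ne (kept-HeadImage n) ts'))
  ... | same-ne _ refl with ∈S-sub-inv (θZ Z) ts' mem
  ... | c , mc , eN = inj₁ (c , oarg o mc , eN)
  origin-ne u Z mem h' ts' o e (replaced m g b em) with ne-inj
      (trans e (sub-ne (replaced-HeadImage Z m g b em) ts'))
  ... | same-ne _ refl with ∈++-split (renPS 𝔖 (inl Z) b) mem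
  ... | inj₁ m1 with ∈PS-ren-inv (inl Z) b m1
  ... | b0 , mb0 , eN = inj₂ (inside-arg m g b em mb0 ε here (inl Z) (inl-inj Z) (λ v → refl) eN)
  origin-ne u Z mem h' ts' o e (replaced m g b em) | same-ne _ refl | inj₂ m2 with ∈S-sub-inv
      (θZ Z) ts' m2
  ... | c , mc , eN = inj₁ (c , oarg o mc , eN)

  origin : ∀ {τ τN} (u : Nf 𝔖 (Γ ⧺ Y) τ) {Z : Ctx Sort} {N : Nf 𝔖 ((Γ ⧺ X) ⧺ Z) τN} →
           Occ (sub 𝔖 u θ) Z N → Origin u Z N
  origin u here = inj₁ (u , here , refl)
  origin u (olam p) with origin u p
  ... | inj₁ (lam t'' , o , e) = inj₁ (t'' , olam o , lam-inj e)
  ... | inj₂ (inside-arg j gj bj ej mb Z2 {N0 = lam N0'} o κ i eκ e) =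
    inj₂ (inside-arg j gj bj ej mb (Z2 ▷ _) (olam o) (liftR κ) (liftR-inj i) (λ v → cong vs (eκ v))
        (lam-inj e))
  origin u (oarg {Z = Z} p mem) with origin u p
  ... | inj₁ (ne h' ts' , o , e) = origin-ne u Z mem h' ts' o e (classifyHead Z h')
  ... | inj₂ (inside-arg j gj bj ej mb Z2 {N0 = ne h0 ts0} o κ i eκ e) with ne-inj e
  ... | same-ne _ refl with ∈S-ren-inv κ ts0 mem
  ... | c0 , mc , eN = inj₂ (inside-arg j gj bj ej mb Z2 (oarg o mc) κ i eκ eN)

  no-image-inside-arg : ∀ {τN} {Z : Ctx Sort} {N : Nf 𝔖 ((Γ ⧺ X) ⧺ Z) τN} → InsideArg Z N →
                        (Z3 : Ctx Sort) {a : Sort} {M : Nf 𝔖 (((Γ ⧺ X) ⧺ Z) ⧺ Z3) (ι a)} →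
                        Occ N Z3 M →
                        ∀ {σm ρm} (m : Var Y σm) (gm : Head 𝔖 (Γ ⧺ X) ρm)
                          (bm : PSp 𝔖 (Γ ⧺ X) ρm σm) →
                        ss m ≡ expand 𝔖 σm gm bm → StartsWith (λ v → inl Z3 (inl Z v)) gm bm M → ⊥
  no-image-inside-arg {Z = Z} (inside-arg j gj bj ej mb Z2 o κ i eκ refl) Z3 o3 m gm bm em im =
    no-image-in-renamed-argument j gj bj ej mb Z2 o κ i (inl Z) eκ Z3 o3 m gm bm em im

  unsub-prefix : ∀ {ρ τ a} (X' : Ctx Sort) (ts' : Sp 𝔖 ((Γ ⧺ Y) ⧺ X') ρ a) (ak : PSp 𝔖 (Γ ⧺ Y) ρ τ)
                 {rest : Sp 𝔖 ((Γ ⧺ X) ⧺ X') τ a} →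
                 subSp 𝔖 ts' (θZ X') ≡ renPS 𝔖 (inl X') (subPS ak θ) ++ rest →
                 Σ (Sp 𝔖 ((Γ ⧺ Y) ⧺ X') τ a) λ post → ts' ≡ renPS 𝔖 (inl X') ak ++ post
  unsub-prefix X' ts' ak e with subSp-split (θZ X') ts' (renPS 𝔖 (inl X') (subPS ak θ)) e
  ... | pre , post , e1 , e2 , _ =
    post , trans e1
        (cong (λ q → q ++ post)
        (subPS-injective X' pre (renPS 𝔖 (inl X') ak) (trans e2 (renPS-inl-sub X' θ ak))))

  Occ⇒SubE : ∀ {σ τ ρ a} (i : Var U σ) (k : Var U τ) (hk : Head 𝔖 (Γ ⧺ Y) ρ)
             (ak : PSp 𝔖 (Γ ⧺ Y) ρ τ) →
             us k ≡ expand 𝔖 τ hk ak → (X' : Ctx Sort) (post : Sp 𝔖 ((Γ ⧺ Y) ⧺ X') τ a) →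
             Occ (us i) X' (ne (renH 𝔖 (inl X') hk) (renPS 𝔖 (inl X') ak ++ post)) →
             SubE 𝔖 Y (us i) (us k)
  Occ⇒SubE i k hk ak ek X' post o = _ , hk , ak , ek , X' , _ , post , Occ⇒⊵ Y o

  renH-fun : ∀ {Δ Δ' : Ctx Sort} {ρ} (κ : Ren Δ Δ') {f : Sym ρ} (g : Head 𝔖 Δ ρ) →
             fun f ≡ renH 𝔖 κ g → IsFun g
  renH-fun κ (fun f') refl = f' , refl

  no-SubE-fun : ∀ {σ τ ρ a} (i : Var U σ) (k : Var U τ) → ¬ SameVar i k →
                (f : Sym ρ) (ak : PSp 𝔖 (Γ ⧺ Y) ρ τ) → us k ≡ expand 𝔖 τ (fun f) ak →
                (X' : Ctx Sort) (rest : Sp 𝔖 ((Γ ⧺ X) ⧺ X') τ a) →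
                Occ (sub 𝔖 (us i) θ) X'
                  (ne (fun f) (renPS 𝔖 (inl X') ([] ++ᴾ subPS ak θ) ++ rest)) →
                ⊥
  no-SubE-fun i k ns f ak ek X' rest o with origin (us i) o
  ... | inj₂ inside with fun-headed-Y-arg k f ak ek
  ... | _ , a0 , ma , _ , l , q with image-at-Y ε l a0 q
  ... | Z' , _ , _ , oM , (_ , gl , bl , el) , im =
    let mem = ∈PS→∈++ rest (ren-∈PS (inl X') (∈++ᴾ-right [] (sub-∈PS θ ma)))
        o2 = Occ-trans-ε (oarg here mem) (Occ-ren (inl X') oM)
        im2 = StartsWith-ren {g = gl} {b = bl} (liftsR Z' (inl X')) (λ v → inl Z' (inl X' v))
                (λ v → liftsR-inl Z' (inl X') v) im
    in no-image-inside-arg inside Z' o2 l gl bl el im2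
  no-SubE-fun i k ns f ak ek X' rest o | inj₁ (ne h' ts' , o' , eN) with classifyHead X' h'
  ... | kept n with ne-inj (trans eN (sub-ne (kept-HeadImage n) ts'))
  ... | same-ne eH es with Kept-injective kept-fun n eH
  ... | refl
    with unsub-prefix X' ts' ak
           (trans (sym es) (cong (λ q → renPS 𝔖 (inl X') q ++ rest) ([]++ᴾ (subPS ak θ))))
  ... | post , ets' =
    us-no-SubE i k ns
      (Occ⇒SubE i k (fun f) ak ek X' post (subst (λ w → Occ (us i) X' (ne (fun f) w)) ets' o'))
  no-SubE-fun i k ns f ak ek X' rest o | inj₁ (ne h' ts' , o' , eN) | replaced m g' b' em
    with ne-inj (trans eN (sub-ne (replaced-HeadImage X' m g' b' em) ts'))
  ... | same-ne eH es
    with Prefix-comparable (inl-inj X') (subPS ak θ) b'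
           (trans (cong (λ q → renPS 𝔖 (inl X') q ++ rest) (sym ([]++ᴾ (subPS ak θ)))) es)
  ... | inj₁ pre with fun-headed-Y-arg k f ak ek
  ... | _ , a0 , ma , _ , l , q with image-at-Y ε l a0 q
  ... | Z' , _ , _ , oM , (_ , gl , bl , el) , im =
    no-image-in-argument m g' b' em (Prefix-∈ pre (sub-∈PS θ ma)) Z' oM l gl bl el im
  no-SubE-fun i k ns f ak ek X' rest o | inj₁ (ne h' ts' , o' , eN) | replaced m g' b' em
    | same-ne eH es | inj₂ pre =
    ss-fun-head-open-arg m g' b' em (renH-fun (inl X') g' eH) λ mb v q →
      let (c , _ , ec) = ∈PS-sub-inv θ ak (Prefix-∈ pre mb)
      in image-argument-closed ε c m g' b' em mb (trans (ren-id (λ _ → refl) _) ec) v q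

  ++-renPS-++ᴾ : ∀ {ρ τ1 τ2 a} (X' : Ctx Sort) (b : PSp 𝔖 (Γ ⧺ X) ρ τ1) (q : PSp 𝔖 (Γ ⧺ X) τ1 τ2)
                 (rest : Sp 𝔖 ((Γ ⧺ X) ⧺ X') τ2 a) →
                 renPS 𝔖 (inl X') (b ++ᴾ q) ++ rest ≡ renPS 𝔖 (inl X') b ++ renPS 𝔖
                   (inl X') q ++ rest
  ++-renPS-++ᴾ X' b q rest = trans (cong (λ w → w ++ rest) (renPS-++ᴾ (inl X') b q))
      (++ᴾ-++ (renPS 𝔖 (inl X') b) (renPS 𝔖 (inl X') q) rest)

  no-SubE-Y : ∀ {σ τ ρh ρ a} (i : Var U σ) (k : Var U τ) → ¬ SameVar i k →
              (l : Var Y ρh) (g : Head 𝔖 (Γ ⧺ X) ρ) (b : PSp 𝔖 (Γ ⧺ X) ρ ρh) →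
              ss l ≡ expand 𝔖 ρh g b → (ak : PSp 𝔖 (Γ ⧺ Y) ρh τ) →
              us k ≡ expand 𝔖 τ (var (inr Y l)) ak →
              (X' : Ctx Sort) (rest : Sp 𝔖 ((Γ ⧺ X) ⧺ X') τ a) →
              Occ (sub 𝔖 (us i) θ) X'
                (ne (renH 𝔖 (inl X') g) (renPS 𝔖 (inl X') (b ++ᴾ subPS ak θ) ++ rest)) →
              ⊥
  no-SubE-Y i k ns l g b el ak ek X' rest o with origin (us i) o
  ... | inj₂ inside =
    no-image-inside-arg inside ε here l g b el
      (renPS 𝔖 (inl X') (subPS ak θ) ++ rest , cong (ne _) (++-renPS-++ᴾ X' b (subPS ak θ) rest))
  ... | inj₁ (ne h' ts' , o' , eN) with classifyHead X' h'
  ... | kept n with ne-inj (trans eN (sub-ne (kept-HeadImage n) ts'))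
  ... | same-ne eH es =
    kept≢replaced n l g b el (sym eH) ts' (trans (sym es) (++-renPS-++ᴾ X' b (subPS ak θ) rest))
  no-SubE-Y i k ns l g b el ak ek X' rest o | inj₁ (ne h' ts' , o' , eN) | replaced m g' b' em
    with ne-inj (trans eN (sub-ne (replaced-HeadImage X' m g' b' em) ts'))
  ... | same-ne eH es with eqv l m
  no-SubE-Y {ρh = ρh} i k ns l g b el ak ek X' rest o | inj₁ (ne h' ts' , o' , eN)
    | replaced .l g' b' em | same-ne eH es | same
    with expand-inj ρh g b g' b' (trans (sym el) em)
  ... | refl , refl , refl
    with unsub-prefix X' ts' ak
           (sym (++-cancelˡ (renPS 𝔖 (inl X') b)
                  (trans (sym (++-renPS-++ᴾ X' b (subPS ak θ) rest)) es)))
  ... | post , ets' =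
    us-no-SubE i k ns
      (Occ⇒SubE i k (var (inr Y l)) ak ek X' post (subst (λ w → Occ (us i) X' (ne _ w)) ets' o'))
  no-SubE-Y i k ns l g b el ak ek X' rest o | inj₁ (ne h' ts' , o' , eN)
    | replaced .(wkv l m') g' b' em | same-ne eH es | diff .l m' =
    distinct-replaced X' l (wkv l m') (¬SameVar-wkv l m') g g' b b' el em eH
      (trans (sym (++-renPS-++ᴾ X' b (subPS ak θ) rest)) es)

  no-SubE : ∀ {σ τ} (i : Var U σ) (k : Var U τ) → ¬ SameVar i k →
            SubE 𝔖 X (sub 𝔖 (us i) θ) (sub 𝔖 (us k) θ) → ⊥
  no-SubE {τ = τ} i k ns (_ , h , ps , eqk , X' , _ , rest , p) with us-expanded k
  ... | _ , hk , ak , ek with topHead k hk ak ek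
  ... | top-fun f
    with expand-inj τ h ps (fun f) ([] ++ᴾ subPS ak θ)
           (trans (sym eqk) (sub-us k (fun f) ak ek hi-fun))
  ... | refl , refl , refl = no-SubE-fun i k ns f ak ek X' rest (⊵⇒Occ X p)
  no-SubE {τ = τ} i k ns (_ , h , ps , eqk , X' , _ , rest , p) | _ , hk , ak , ek | top-Y l g b el
    with expand-inj τ h ps g (b ++ᴾ subPS ak θ)
           (trans (sym eqk) (sub-us k _ ak ek (top-Y-image l el)))
  ... | refl , refl , refl = no-SubE-Y i k ns l g b el ak ek X' rest (⊵⇒Occ X p)

  has-fv : ∀ {σ} (i : Var U σ) → Σ (Ty Sort) λ σ' → Σ (Var (Γ ⧺ X) σ') λ v → v ∈F sub 𝔖 (us i) θ
  has-fv {σ} i with us-expanded i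
  ... | _ , h , a , e with topHead i h a e
  ... | top-fun f with fun-headed-Y-arg i f a e
  ... | _ , a0 , ma , _ , l , q with image-at-Y ε l a0 q
  ... | _ , _ , _ , oM , (_ , _ , _ , el) , im with StartsWith-fv l el im
  ... | τv , v , pv =
    τv , v , subst (_ ∈F_) (sym (sub-us i (fun f) a e hi-fun))
               (fv-expand-arg σ (fun f) (∈++ᴾ-right [] (sub-∈PS θ ma)) (Occ-fv oM v pv))
  has-fv {σ} i | ρ , h , a , e | top-Y l g b el with ss-fv l
  ... | σ' , v , p with fv-expand-inv ρ g b (subst (_ ∈F_) el p)
  ... | inj₁ hv =
    σ' , v , subst (_ ∈F_) (sym (sub-us i _ a e (top-Y-image l el)))
               (HeadVar-fv σ (b ++ᴾ subPS a θ) hv)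
  ... | inj₂ (_ , _ , mb0 , q) =
    σ' , v , subst (_ ∈F_) (sym (sub-us i _ a e (top-Y-image l el)))
               (fv-expand-arg σ g (∈++ᴾ-left (subPS a θ) mb0) q)

  no-Γ : ∀ {σ σ'} (i : Var U σ) (γ : Var Γ σ') → inl X γ ∈F sub 𝔖 (us i) θ → ⊥
  no-Γ i γ p with fv-sub ε (us i) p
  ... | inj₁ (γ' , q , e) = us-no-Γ i γ' q
  ... | inj₂ (inj₁ (() , _))
  ... | inj₂ (inj₂ (σm , m , q , v , e , fq)) = ss-no-Γ m γ (subst (_∈F ss m) (sym e) fq)

  expanded : ∀ {σ} (i : Var U σ) → Expanded 𝔖 (sub 𝔖 (us i) θ)
  expanded i with us-expanded i
  ... | ρ , h , a , e with headImage ε h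
  ... | _ , H , P , hi = _ , H , P ++ᴾ subPS a θ , sub-us i h a e hi

lemma11 : (𝔖 : Signature) {Γ X Y U : Ctx (Signature.Sort 𝔖)} (us : Tms 𝔖 (Γ ⧺ Y) U)
          (ss : Tms 𝔖 (Γ ⧺ X) Y) →
          DHPVarArgList 𝔖 Γ Y us → DHPVarArgList 𝔖 Γ X ss →
          DHPVarArgList 𝔖 Γ X (λ j → sub 𝔖 (us j) (μ 𝔖 X Y ss))
lemma11 𝔖 us ss hu hs i =
  has-fv i , no-Γ i , expanded i , no-SubE i
  where open Composition 𝔖 us ss hu hs
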